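{- Let $P$ and $P'$ be paving matroids of the same rank $r$ on ground sets $\{1,\ldots,n\}$ of the same size $n$. If the multisets $\{|X| : X$ a non-trivial copoint of $P\}$ and $\{|X| : X$ a non-trivial copoint of $P'\}$ are equal, then $\mathcal{G}(P)=\mathcal{G}(P')$. Moreover, if $P$ and $P'$ are sparse paving matroids of the same rank on the same number of elements with the same number of bases, then $\mathcal{G}(P)=\mathcal{G}(P')$.
   Context: For a rank-$r$ matroid $M$ on $\{1,\ldots,n\}$ and a permutation $\pi$ of $\{1,\ldots,n\}$, the rank sequence $\underline{r}(\pi)=(r_1,\ldots,r_n)$ is given by $r_1=r(\{\pi(1)\})$ and $r_j=r(\{\pi(1),\ldots,\pi(j)\})-r(\{\pi(1),\ldots,\pi(j-1)\})$ for $j\ge2$; it is a $(0,1)$-sequence with exactly $r$ ones. To each $(0,1)$-sequence $\underline{r}$ associate a formal symbol $[\underline{r}]$ (the symbols are linearly independent). The $\mathcal{G}$-invariant is $\mathcal{G}(M)=\sum_\pi[\underline{r}(\pi)]$, summed over all $n!$ permutations. A rank-$r$ matroid is paving if all its circuits have $r$ or $r+1$ elements. A copoint is a flat of rank $r-1$; it is trivial if it has $r-1$ elements and non-trivial if it has at least $r$ elements. A paving matroid is sparse if all its non-trivial copoints have exactly $r$ elements. -}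

module Defs where

open import Data.Nat using (ℕ; zero; suc; _+_; _∸_; _≤_; _<_)
open import Data.Nat.Properties using (_≟_; _<?_)
open import Data.Bool using (Bool; true; false)
open import Data.Fin using (Fin)
open import Data.Fin.Subset using (Subset; _∪_; _∩_; _⊆_; _⊂_; ⁅_⁆; ∣_∣; ⊤; ⊥; _∈_; _∉_)
open import Data.Fin.Subset.Properties using (_∈?_; _⊆?_)
open import Data.Fin.Properties using (all?)
open import Data.Vec using (Vec; []; _∷_; allFin)
open import Data.Vec.Membership.Propositional using () renaming (_∈_ to _∈ᵥ_)
import Data.Vec.Membership.DecPropositional as VecDec
open import Data.Vec.Properties using (≡-dec)
open import Data.List using (List; []; _∷_; concatMap; map; filter; length)
open import Data.Product using (_×_)
open import Data.Sum using (_⊎_)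
open import Relation.Nullary using (¬_; Dec; yes; no)
open import Relation.Nullary.Decidable using (_×-dec_; _⊎-dec_; ¬?; _→-dec_)
open import Relation.Unary using (Pred; Decidable)
open import Relation.Binary.PropositionalEquality using (_≡_)
import Data.Fin.Properties

allVecs : ∀ {a} {A : Set a} → List A → (k : ℕ) → List (Vec A k)
allVecs xs zero    = [] ∷ []
allVecs xs (suc k) = concatMap (λ x → map (x ∷_) (allVecs xs k)) xs

count : ∀ {a p} {A : Set a} {P : Pred A p} → Decidable P → List A → ℕ
count P? xs = length (filter P? xs)

allSubsets : (n : ℕ) → List (Subset n)
allSubsets n = allVecs (true ∷ false ∷ []) n

-- all permutations π of {0,…,n-1}, represented by the vector (π(1),…,π(n));
-- a length-n vector over Fin n is a permutation iff every element occurs.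
IsPerm : ∀ {n} → Vec (Fin n) n → Set
IsPerm {n} v = ∀ (i : Fin n) → i ∈ᵥ v

isPerm? : ∀ {n} → Decidable (IsPerm {n})
isPerm? {n} v = all? (λ i → VecDec._∈?_ (Data.Fin.Properties._≟_ {n}) i v)

allPerms : (n : ℕ) → List (Vec (Fin n) n)
allPerms n = filter isPerm? (allVecs (Data.Vec.toList (allFin n)) n)

record Matroid (n : ℕ) : Set where
  field
    rk      : Subset n → ℕ
    rk-card : ∀ X → rk X ≤ ∣ X ∣
    rk-mono : ∀ {X Y} → X ⊆ Y → rk X ≤ rk Y
    rk-sub  : ∀ X Y → rk (X ∪ Y) + rk (X ∩ Y) ≤ rk X + rk Y

open Matroid public

module _ {n : ℕ} (M : Matroid n) where

  rank : ℕ
  rank = rk M ⊤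

  Independent : Subset n → Set
  Independent X = rk M X ≡ ∣ X ∣

  Dependent : Subset n → Set
  Dependent X = ¬ Independent X

  Circuit : Subset n → Set
  Circuit C = Dependent C × (∀ D → D ⊂ C → Independent D)

  Basis : Subset n → Set
  Basis B = Independent B × (∀ e → e ∉ B → Dependent (B ∪ ⁅ e ⁆))

  Paving : Set
  Paving = ∀ C → Circuit C → (∣ C ∣ ≡ rank ⊎ ∣ C ∣ ≡ suc rank)

  Flat : Subset n → Set
  Flat X = ∀ e → e ∉ X → rk M X < rk M (X ∪ ⁅ e ⁆)

  Copoint : Subset n → Set
  Copoint X = Flat X × suc (rk M X) ≡ rank

  NontrivialCopoint : Subset n → Set
  NontrivialCopoint X = Copoint X × rank ≤ ∣ X ∣

  SparsePaving : Set
  SparsePaving = Paving × (∀ X → NontrivialCopoint X → ∣ X ∣ ≡ rank)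

  flat? : Decidable Flat
  flat? X = all? (λ e → ¬? (e ∈? X) →-dec (rk M X <? rk M (X ∪ ⁅ e ⁆)))

  nontrivialCopoint? : Decidable NontrivialCopoint
  nontrivialCopoint? X = (flat? X ×-dec (suc (rk M X) ≟ rank)) ×-dec (rank Data.Nat.≤? ∣ X ∣)

  independent? : Decidable Independent
  independent? X = rk M X ≟ ∣ X ∣

  basis? : Decidable Basis
  basis? B = independent? B ×-dec all? (λ e → ¬? (e ∈? B) →-dec ¬? (independent? (B ∪ ⁅ e ⁆)))

  numNontrivialCopoints : ℕ → ℕ
  numNontrivialCopoints k =
    count (λ X → nontrivialCopoint? X ×-dec (∣ X ∣ ≟ k)) (allSubsets n)

  numBases : ℕ
  numBases = count basis? (allSubsets n)

  rankSeqFrom : ∀ {k} → Subset n → Vec (Fin n) k → Vec ℕ k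
  rankSeqFrom S []       = []
  rankSeqFrom S (x ∷ xs) = (rk M (S ∪ ⁅ x ⁆) ∸ rk M S) ∷ rankSeqFrom (S ∪ ⁅ x ⁆) xs

  rankSeq : Vec (Fin n) n → Vec ℕ n
  rankSeq π = rankSeqFrom ⊥ π

  -- coefficient of the symbol [s] in the G-invariant:
  -- the number of permutations π with rank sequence s
  Gcoeff : Vec ℕ n → ℕ
  Gcoeff s = count (λ π → ≡-dec _≟_ (rankSeq π) s) (allPerms n)

-- equality of G-invariants: since the symbols [s] are linearly independent,
-- G(M) = G(M') iff all coefficients agree
_≡G_ : ∀ {n} → Matroid n → Matroid n → Set
_≡G_ {n} M M' = ∀ (s : Vec ℕ n) → Gcoeff M s ≡ Gcoeff M' s

module Submission where

-- In a paving matroid every set with fewer than r elements is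
-- independent.  So along a permutation π the rank grows by one per step until
-- r - 1 elements are placed, stays at r - 1 until the placed prefix first
-- spans, and is constant afterwards: the rank sequence of π only depends on its
-- spanning time.  The number of permutations whose first j elements do not span
-- is n! for j < r, 0 for j ≥ n, and otherwise j! (n ∸ j)! times the number of
-- j-sets of rank r - 1; for j ≥ r these are the j-subsets of the non-trivial
-- copoints, each lying in exactly one.  Hence every coefficient of G is a
-- function of n, r and the copoint-size counts.  In a sparse paving matroid
-- every r-set is a basis or a non-trivial copoint and there are no other
-- non-trivial copoints, so the number of bases fixes these counts.

open import Defs
open import Data.Nat using (ℕ; zero; suc; _+_; _*_; _∸_; _≤_; _<_; z≤n; s≤s; _!)
open import Data.Nat.Properties
open import Data.Nat.Combinatorics using (_C_; nCk≡nC[n∸k]; nCn≡1; nCk+nC[k+1]≡[n+1]C[k+1])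
open import Data.Nat.Solver using (module +-*-Solver)
open import Data.Bool using (true; false)
import Data.Bool.Properties as BoolP
open import Data.Fin using (Fin; zero; suc)
import Data.Fin.Properties as FinP
open import Data.Fin.Subset using (Subset; _∪_; _∩_; _⊆_; _⊂_; ⁅_⁆; ∣_∣; ⊤; ⊥; _∈_; _∉_)
open import Data.Fin.Subset.Properties
  using ( _∈?_; _⊆?_; _⊂?_; drop-there; drop-∷-⊆; p⊆q⇒∣p∣≤∣q∣; p⊂q⇒∣p∣<∣q∣; ⊆-antisym; ⊆-max; ⊥⊆
        ; ∪-identityʳ; ∪-assoc; ∣⊥∣≡0; ∣⊤∣≡n; ∣p∣≡n⇒p≡⊤; ∣p∣≤n; ∣⁅x⁆∣≡1; ∈⊤; ∉⊥
        ; x∈p∪q⁻; p⊆p∪q; q⊆p∪q; x∈p∩q⁺; x∈⁅x⁆; x∈⁅y⁆⇒x≡y; anySubset? )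
open import Data.Vec using (Vec; []; _∷_; here; there; toList; allFin; tabulate)
open import Data.Vec.Properties using (≡-dec; ∷-injective; []=⇒lookup; lookup⇒[]=; lookup∘tabulate)
open import Data.Vec.Membership.Propositional using () renaming (_∈_ to _∈ᵥ_)
import Data.Vec.Membership.DecPropositional as VecDec
open import Data.List using (List; []; _∷_; _++_; map; concatMap; filter)
import Data.List as List
open import Data.List.Membership.Propositional using () renaming (_∈_ to _∈ˡ_)
open import Data.List.Membership.Propositional.Properties using (∈-filter⁺; ∈-filter⁻; ∈-allFin)
open import Data.List.Relation.Unary.Any using (here; there)
open import Data.Vec.Relation.Unary.Any using (here; there)
open import Data.Product using (_×_; _,_; proj₁; proj₂; ∃)
open import Data.Sum using (_⊎_; inj₁; inj₂; [_,_]′)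
open import Data.Empty using (⊥-elim)
open import Relation.Nullary using (¬_; Dec; yes; no; does)
open import Relation.Nullary.Decidable using (_×-dec_; ¬?; _→-dec_)
open import Relation.Unary using (Pred; Decidable)
open import Relation.Binary.PropositionalEquality

open +-*-Solver using (solve; _:*_; _:+_; _:=_; con)

-- Indicator sums.  Every count in the development is rewritten as a sum
-- ∑ xs (λ x → 𝟙 (P? x) * …) of indicators over an explicit enumeration, and
-- manipulated with the usual rules (linearity, Fubini, fibres).

module IndicatorSums where

  𝟙 : ∀ {p} {P : Set p} → Dec P → ℕ
  𝟙 (yes _) = 1
  𝟙 (no _)  = 0

  ∑ : ∀ {a} {A : Set a} → List A → (A → ℕ) → ℕ
  ∑ []       f = 0
  ∑ (x ∷ xs) f = f x + ∑ xs f

  module _ {p q} {P : Set p} {Q : Set q} where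

    𝟙-× : (d : Dec P) (e : Dec Q) → 𝟙 (d ×-dec e) ≡ 𝟙 d * 𝟙 e
    𝟙-× (yes _) (yes _) = refl
    𝟙-× (yes _) (no _)  = refl
    𝟙-× (no _)  _       = refl

    𝟙-⇔ : (d : Dec P) (e : Dec Q) → (P → Q) → (Q → P) → 𝟙 d ≡ 𝟙 e
    𝟙-⇔ (yes _) (yes _) f g = refl
    𝟙-⇔ (yes x) (no ¬y) f g = ⊥-elim (¬y (f x))
    𝟙-⇔ (no ¬x) (yes y) f g = ⊥-elim (¬x (g y))
    𝟙-⇔ (no _)  (no _)  f g = refl

  module _ {p} {P : Set p} where

    𝟙-yes : P → (d : Dec P) → 𝟙 d ≡ 1
    𝟙-yes x (yes _) = refl
    𝟙-yes x (no ¬x) = ⊥-elim (¬x x)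

    𝟙-no : ¬ P → (d : Dec P) → 𝟙 d ≡ 0
    𝟙-no ¬x (yes x) = ⊥-elim (¬x x)
    𝟙-no ¬x (no _)  = refl

    𝟙-¬ : (d : Dec P) → 𝟙 (¬? d) + 𝟙 d ≡ 1
    𝟙-¬ (yes _) = refl
    𝟙-¬ (no _)  = refl

    𝟙-guard : (d : Dec P) {a b : ℕ} → (P → a ≡ b) → 𝟙 d * a ≡ 𝟙 d * b
    𝟙-guard (yes x) f = cong (1 *_) (f x)
    𝟙-guard (no _)  f = refl

  𝟙-transport : ∀ {a} {A : Set a} (_≟ᴬ_ : (x y : A) → Dec (x ≡ y)) (x y : A) (F : A → ℕ) →
                𝟙 (x ≟ᴬ y) * F x ≡ 𝟙 (x ≟ᴬ y) * F y
  𝟙-transport _≟ᴬ_ x y F with x ≟ᴬ y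
  ... | yes refl = refl
  ... | no _     = refl

  module _ {a} {A : Set a} where

    count≡∑ : ∀ {p} {P : Pred A p} (P? : Decidable P) (xs : List A) →
              count P? xs ≡ ∑ xs (λ x → 𝟙 (P? x))
    count≡∑ P? [] = refl
    count≡∑ P? (x ∷ xs) with P? x
    ... | yes _ = cong suc (count≡∑ P? xs)
    ... | no _  = count≡∑ P? xs

    ∑-filter : ∀ {p} {P : Pred A p} (P? : Decidable P) (xs : List A) (f : A → ℕ) →
               ∑ (filter P? xs) f ≡ ∑ xs (λ x → 𝟙 (P? x) * f x)
    ∑-filter P? [] f = refl
    ∑-filter P? (x ∷ xs) f with P? x
    ... | yes _ = cong₂ _+_ (sym (+-identityʳ (f x))) (∑-filter P? xs f)
    ... | no _  = ∑-filter P? xs f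

    ∑-cong : ∀ (xs : List A) {f g : A → ℕ} → (∀ x → f x ≡ g x) → ∑ xs f ≡ ∑ xs g
    ∑-cong []       e = refl
    ∑-cong (x ∷ xs) e = cong₂ _+_ (e x) (∑-cong xs e)

    ∑-zero : ∀ (xs : List A) {f : A → ℕ} → (∀ x → f x ≡ 0) → ∑ xs f ≡ 0
    ∑-zero []       e = refl
    ∑-zero (x ∷ xs) e rewrite e x = ∑-zero xs e

    ∑-++ : ∀ (xs ys : List A) (f : A → ℕ) → ∑ (xs ++ ys) f ≡ ∑ xs f + ∑ ys f
    ∑-++ []       ys f = refl
    ∑-++ (x ∷ xs) ys f = trans (cong (f x +_) (∑-++ xs ys f)) (sym (+-assoc (f x) _ _))

    ∑-+ : ∀ (xs : List A) (f g : A → ℕ) → ∑ xs (λ x → f x + g x) ≡ ∑ xs f + ∑ xs g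
    ∑-+ []       f g = refl
    ∑-+ (x ∷ xs) f g rewrite ∑-+ xs f g =
      solve 4 (λ a b c d → (a :+ b) :+ (c :+ d) := (a :+ c) :+ (b :+ d)) refl
        (f x) (g x) (∑ xs f) (∑ xs g)

    ∑-*ˡ : ∀ (xs : List A) (c : ℕ) (f : A → ℕ) → ∑ xs (λ x → c * f x) ≡ c * ∑ xs f
    ∑-*ˡ []       c f = sym (*-zeroʳ c)
    ∑-*ˡ (x ∷ xs) c f rewrite ∑-*ˡ xs c f = sym (*-distribˡ-+ c (f x) (∑ xs f))

  module _ {a b} {A : Set a} {B : Set b} where

    ∑-map : ∀ (h : A → B) (xs : List A) (f : B → ℕ) → ∑ (map h xs) f ≡ ∑ xs (λ x → f (h x))
    ∑-map h []       f = refl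
    ∑-map h (x ∷ xs) f = cong (f (h x) +_) (∑-map h xs f)

    ∑-concatMap : ∀ (h : A → List B) (xs : List A) (f : B → ℕ) →
                  ∑ (concatMap h xs) f ≡ ∑ xs (λ x → ∑ (h x) f)
    ∑-concatMap h []       f = refl
    ∑-concatMap h (x ∷ xs) f = trans (∑-++ (h x) _ f) (cong (∑ (h x) f +_) (∑-concatMap h xs f))

    ∑-swap : ∀ (xs : List A) (ys : List B) (f : A → B → ℕ) →
             ∑ xs (λ x → ∑ ys (f x)) ≡ ∑ ys (λ y → ∑ xs (λ x → f x y))
    ∑-swap []       ys f = sym (∑-zero ys (λ _ → refl))
    ∑-swap (x ∷ xs) ys f = trans (cong (∑ ys (f x) +_) (∑-swap xs ys f))
                                 (sym (∑-+ ys (f x) (λ y → ∑ xs (λ x′ → f x′ y))))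

  below : ℕ → List ℕ
  below zero    = []
  below (suc B) = B ∷ below B

  ∑-below-δ₀ : ∀ B m → B ≤ m → ∑ (below B) (λ k → 𝟙 (m ≟ k)) ≡ 0
  ∑-below-δ₀ zero    m _  = refl
  ∑-below-δ₀ (suc B) m le rewrite 𝟙-no (λ e → <-irrefl (sym e) le) (m ≟ B) =
    ∑-below-δ₀ B m (≤-trans (n≤1+n B) le)

  ∑-below-δ : ∀ B m → m < B → ∑ (below B) (λ k → 𝟙 (m ≟ k)) ≡ 1
  ∑-below-δ (suc B) m (s≤s le) with m ≟ B
  ... | yes refl = cong suc (∑-below-δ₀ B m ≤-refl)
  ... | no ne    = ∑-below-δ B m (≤∧≢⇒< le ne)

  𝟙-split-zero : ∀ t → 𝟙 (t ≟ 0) + 𝟙 (0 <? t) ≡ 1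
  𝟙-split-zero zero    = refl
  𝟙-split-zero (suc t) = refl

  𝟙-split-suc : ∀ t j → 𝟙 (t ≟ suc j) + 𝟙 (suc j <? t) ≡ 𝟙 (j <? t)
  𝟙-split-suc t j with t ≟ suc j
  ... | yes refl = trans (cong (1 +_) (𝟙-no (<-irrefl refl) (suc j <? suc j))) (sym (𝟙-yes (n<1+n j) (j <? suc j)))
  ... | no t≢j+1 = 𝟙-⇔ (suc j <? t) (j <? t) (<-trans (n<1+n j)) (λ j<t → ≤∧≢⇒< j<t (λ e → t≢j+1 (sym e)))

  ∑-fibres : ∀ {a} {A : Set a} (xs : List A) (τ : A → ℕ) (B : ℕ) → (∀ x → τ x < B) → (h : A → ℕ) →
             ∑ xs h ≡ ∑ (below B) (λ k → ∑ xs (λ x → 𝟙 (τ x ≟ k) * h x))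
  ∑-fibres xs τ B τ<B h =
    trans (∑-cong xs (λ x → sym (fibre x))) (∑-swap xs (below B) (λ x k → 𝟙 (τ x ≟ k) * h x))
    where
    open ≡-Reasoning
    fibre : ∀ x → ∑ (below B) (λ k → 𝟙 (τ x ≟ k) * h x) ≡ h x
    fibre x = begin
      ∑ (below B) (λ k → 𝟙 (τ x ≟ k) * h x) ≡⟨ ∑-cong (below B) (λ k → *-comm (𝟙 (τ x ≟ k)) (h x)) ⟩
      ∑ (below B) (λ k → h x * 𝟙 (τ x ≟ k)) ≡⟨ ∑-*ˡ (below B) (h x) _ ⟩
      h x * ∑ (below B) (λ k → 𝟙 (τ x ≟ k)) ≡⟨ cong (h x *_) (∑-below-δ B (τ x) (τ<B x)) ⟩
      h x * 1                               ≡⟨ *-identityʳ (h x) ⟩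
      h x                                   ∎

open IndicatorSums

-- Finite sets.

module FiniteSets where

  _≟S_ : ∀ {n} (X Y : Subset n) → Dec (X ≡ Y)
  _≟S_ = ≡-dec BoolP._≟_

  ∪-least : ∀ {n} {A B C : Subset n} → A ⊆ C → B ⊆ C → A ∪ B ⊆ C
  ∪-least {A = A} {B} A⊆C B⊆C x∈ with x∈p∪q⁻ A B x∈
  ... | inj₁ x∈A = A⊆C x∈A
  ... | inj₂ x∈B = B⊆C x∈B

  ⁅⁆⊆ : ∀ {n} {x : Fin n} {C : Subset n} → x ∈ C → ⁅ x ⁆ ⊆ C
  ⁅⁆⊆ {x = x} x∈C y∈ rewrite x∈⁅y⁆⇒x≡y x y∈ = x∈C

  ∪⁅⁆-∈ : ∀ {n} {x : Fin n} {U : Subset n} → x ∈ U → U ∪ ⁅ x ⁆ ≡ U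
  ∪⁅⁆-∈ x∈U = ⊆-antisym (∪-least (λ m → m) (⁅⁆⊆ x∈U)) (p⊆p∪q _)

  ∣∪⁅⁆∣ : ∀ {n} (x : Fin n) (U : Subset n) → x ∉ U → ∣ U ∪ ⁅ x ⁆ ∣ ≡ suc ∣ U ∣
  ∣∪⁅⁆∣ zero    (true ∷ U)  x∉U = ⊥-elim (x∉U here)
  ∣∪⁅⁆∣ zero    (false ∷ U) x∉U = cong (λ T → suc ∣ T ∣) (∪-identityʳ U)
  ∣∪⁅⁆∣ (suc x) (true ∷ U)  x∉U = cong suc (∣∪⁅⁆∣ x U (λ m → x∉U (there m)))
  ∣∪⁅⁆∣ (suc x) (false ∷ U) x∉U = ∣∪⁅⁆∣ x U (λ m → x∉U (there m))

  ⊆-card-eq : ∀ {n} (U S : Subset n) → U ⊆ S → ∣ U ∣ ≡ ∣ S ∣ → U ≡ S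
  ⊆-card-eq []          []          U⊆S e = refl
  ⊆-card-eq (true ∷ U)  (true ∷ S)  U⊆S e = cong (true ∷_) (⊆-card-eq U S (drop-∷-⊆ U⊆S) (suc-injective e))
  ⊆-card-eq (false ∷ U) (false ∷ S) U⊆S e = cong (false ∷_) (⊆-card-eq U S (drop-∷-⊆ U⊆S) e)
  ⊆-card-eq (true ∷ U)  (false ∷ S) U⊆S e with U⊆S here
  ... | ()
  ⊆-card-eq (false ∷ U) (true ∷ S)  U⊆S e =
    ⊥-elim (1+n≰n (subst (_≤ ∣ S ∣) e (p⊆q⇒∣p∣≤∣q∣ (drop-∷-⊆ U⊆S))))

  ∑-subsets-suc : ∀ n (f : Subset (suc n) → ℕ) →
    ∑ (allSubsets (suc n)) f ≡ ∑ (allSubsets n) (λ T → f (true ∷ T)) + ∑ (allSubsets n) (λ T → f (false ∷ T))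
  ∑-subsets-suc n f = begin
    ∑ (allSubsets (suc n)) f
      ≡⟨ ∑-concatMap (λ b → map (b ∷_) (allSubsets n)) (true ∷ false ∷ []) f ⟩
    ∑ (map (true ∷_) (allSubsets n)) f + (∑ (map (false ∷_) (allSubsets n)) f + 0)
      ≡⟨ cong₂ _+_ (∑-map (true ∷_) (allSubsets n) f)
                   (trans (+-identityʳ _) (∑-map (false ∷_) (allSubsets n) f)) ⟩
    ∑ (allSubsets n) (λ T → f (true ∷ T)) + ∑ (allSubsets n) (λ T → f (false ∷ T)) ∎
    where open ≡-Reasoning

  -- every subset occurs exactly once in the enumeration
  ∑-point : ∀ n (U : Subset n) (F : Subset n → ℕ) → ∑ (allSubsets n) (λ S → 𝟙 (U ≟S S) * F S) ≡ F U
  ∑-point zero    []      F = trans (+-identityʳ _) (*-identityˡ _)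
  ∑-point (suc n) (u ∷ U) F = trans (∑-subsets-suc n _) (split u)
    where
    same : ∀ b (T : Subset n) → 𝟙 ((b ∷ U) ≟S (b ∷ T)) ≡ 𝟙 (U ≟S T)
    same b T = 𝟙-⇔ _ _ (λ e → proj₂ (∷-injective e)) (cong (b ∷_))
    differ : ∀ b c (T : Subset n) → ¬ b ≡ c → 𝟙 ((b ∷ U) ≟S (c ∷ T)) * F (c ∷ T) ≡ 0
    differ b c T b≢c = cong (_* F (c ∷ T)) (𝟙-no (λ e → b≢c (proj₁ (∷-injective e))) ((b ∷ U) ≟S (c ∷ T)))
    on : ∀ b → ∑ (allSubsets n) (λ T → 𝟙 ((b ∷ U) ≟S (b ∷ T)) * F (b ∷ T)) ≡ F (b ∷ U)
    on b = trans (∑-cong (allSubsets n) (λ T → cong (_* F (b ∷ T)) (same b T))) (∑-point n U (λ T → F (b ∷ T)))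
    split : ∀ u → ∑ (allSubsets n) (λ T → 𝟙 ((u ∷ U) ≟S (true ∷ T)) * F (true ∷ T)) +
                  ∑ (allSubsets n) (λ T → 𝟙 ((u ∷ U) ≟S (false ∷ T)) * F (false ∷ T)) ≡ F (u ∷ U)
    split true  = trans (cong₂ _+_ (on true) (∑-zero (allSubsets n) (λ T → differ true false T (λ ())))) (+-identityʳ _)
    split false = cong₂ _+_ (∑-zero (allSubsets n) (λ T → differ false true T (λ ()))) (on false)

  nC0≡1 : ∀ n → n C 0 ≡ 1
  nC0≡1 n = trans (nCk≡nC[n∸k] {0} {n} z≤n) (nCn≡1 n)

  ∷⊆∷ : ∀ {n} a b (T H : Subset n) → T ⊆ H → (a ≡ true → b ≡ true) → (a ∷ T) ⊆ (b ∷ H)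
  ∷⊆∷ a b T H T⊆H a⇒b {zero}  here      rewrite a⇒b refl = here
  ∷⊆∷ a b T H T⊆H a⇒b {suc x} (there m) = there (T⊆H m)

  #subsets : ∀ n (H : Subset n) j →
    ∑ (allSubsets n) (λ S → 𝟙 (∣ S ∣ ≟ j) * 𝟙 (S ⊆? H)) ≡ ∣ H ∣ C j
  #subsets zero    []      zero    = refl
  #subsets zero    []      (suc j) = refl
  #subsets (suc n) (b ∷ H) j       = trans (∑-subsets-suc n _) (split b j)
    where
    -- split by whether 0 ∈ S; if so, then 0 ∈ H and S - {0} is a (j - 1)-subset of H - {0}
    with0 : ∀ j T → 𝟙 (∣ true ∷ T ∣ ≟ suc j) * 𝟙 ((true ∷ T) ⊆? (true ∷ H)) ≡ 𝟙 (∣ T ∣ ≟ j) * 𝟙 (T ⊆? H)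
    with0 j T = cong₂ _*_ (𝟙-⇔ (∣ true ∷ T ∣ ≟ suc j) (∣ T ∣ ≟ j) suc-injective (cong suc))
                          (𝟙-⇔ ((true ∷ T) ⊆? (true ∷ H)) (T ⊆? H) drop-∷-⊆ (λ T⊆H → ∷⊆∷ true true T H T⊆H (λ e → e)))
    without0 : ∀ b j T → 𝟙 (∣ false ∷ T ∣ ≟ j) * 𝟙 ((false ∷ T) ⊆? (b ∷ H)) ≡ 𝟙 (∣ T ∣ ≟ j) * 𝟙 (T ⊆? H)
    without0 b j T = cong (𝟙 (∣ T ∣ ≟ j) *_)
      (𝟙-⇔ ((false ∷ T) ⊆? (b ∷ H)) (T ⊆? H) drop-∷-⊆ (λ T⊆H → ∷⊆∷ false b T H T⊆H (λ ())))
    excluded : ∀ j T → 𝟙 (∣ true ∷ T ∣ ≟ j) * 𝟙 ((true ∷ T) ⊆? (false ∷ H)) ≡ 0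
    excluded j T = trans (cong (𝟙 (∣ true ∷ T ∣ ≟ j) *_) (𝟙-no (λ T⊆H → 0∉ (T⊆H here)) ((true ∷ T) ⊆? (false ∷ H))))
                         (*-zeroʳ (𝟙 (∣ true ∷ T ∣ ≟ j)))
      where
      0∉ : zero ∉ (false ∷ H)
      0∉ ()
    rest : ∀ b j → ∑ (allSubsets n) (λ T → 𝟙 (∣ false ∷ T ∣ ≟ j) * 𝟙 ((false ∷ T) ⊆? (b ∷ H))) ≡ ∣ H ∣ C j
    rest b j = trans (∑-cong (allSubsets n) (without0 b j)) (#subsets n H j)
    split : ∀ b j → ∑ (allSubsets n) (λ T → 𝟙 (∣ true ∷ T ∣ ≟ j) * 𝟙 ((true ∷ T) ⊆? (b ∷ H))) +
                    ∑ (allSubsets n) (λ T → 𝟙 (∣ false ∷ T ∣ ≟ j) * 𝟙 ((false ∷ T) ⊆? (b ∷ H)))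
                    ≡ ∣ b ∷ H ∣ C j
    split true  zero    = trans (cong₂ _+_ (∑-zero (allSubsets n) (λ T → refl)) (rest true zero))
                                (trans (nC0≡1 ∣ H ∣) (sym (nC0≡1 (suc ∣ H ∣))))
    split true  (suc j) = trans (cong₂ _+_ (trans (∑-cong (allSubsets n) (with0 j)) (#subsets n H j)) (rest true (suc j)))
                                (nCk+nC[k+1]≡[n+1]C[k+1] ∣ H ∣ j)
    split false j       = cong₂ _+_ (∑-zero (allSubsets n) (excluded j)) (rest false j)

  elements : (n : ℕ) → List (Fin n)
  elements n = toList (allFin n)

  ∑Fin : (n : ℕ) → (Fin n → ℕ) → ℕ
  ∑Fin zero    g = 0
  ∑Fin (suc n) g = g zero + ∑Fin n (λ x → g (suc x))

  ∑-tabulate : ∀ {m} n (f : Fin n → Fin m) (h : Fin m → ℕ) → ∑ (toList (tabulate f)) h ≡ ∑Fin n (λ x → h (f x))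
  ∑-tabulate zero    f h = refl
  ∑-tabulate (suc n) f h = cong (h (f zero) +_) (∑-tabulate n (λ x → f (suc x)) h)

  ∑Fin-card : ∀ n (S : Subset n) → ∑Fin n (λ x → 𝟙 (x ∈? S)) ≡ ∣ S ∣
  ∑Fin-card zero    []      = refl
  ∑Fin-card (suc n) (s ∷ S) =
    trans (cong (𝟙 (zero ∈? (s ∷ S)) +_) (trans (∑Fin-cong n (λ x → 𝟙-⇔ _ _ drop-there there)) (∑Fin-card n S)))
          (head s)
    where
    ∑Fin-cong : ∀ n {g h : Fin n → ℕ} → (∀ x → g x ≡ h x) → ∑Fin n g ≡ ∑Fin n h
    ∑Fin-cong zero    e = refl
    ∑Fin-cong (suc n) e = cong₂ _+_ (e zero) (∑Fin-cong n (λ x → e (suc x)))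
    head : ∀ s → 𝟙 (zero ∈? (s ∷ S)) + ∣ S ∣ ≡ ∣ s ∷ S ∣
    head true  = refl
    head false = refl

  ∑-card : ∀ n (S : Subset n) → ∑ (elements n) (λ x → 𝟙 (x ∈? S)) ≡ ∣ S ∣
  ∑-card n S = trans (∑-tabulate n (λ x → x) _) (∑Fin-card n S)

  #outside : ∀ n (U : Subset n) → ∑ (elements n) (λ x → 𝟙 (¬? (x ∈? U))) + ∣ U ∣ ≡ n
  #outside n U = begin
    ∑ (elements n) (λ x → 𝟙 (¬? (x ∈? U))) + ∣ U ∣
      ≡⟨ cong (∑ (elements n) (λ x → 𝟙 (¬? (x ∈? U))) +_) (sym (∑-card n U)) ⟩
    ∑ (elements n) (λ x → 𝟙 (¬? (x ∈? U))) + ∑ (elements n) (λ x → 𝟙 (x ∈? U))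
      ≡⟨ sym (∑-+ (elements n) _ _) ⟩
    ∑ (elements n) (λ x → 𝟙 (¬? (x ∈? U)) + 𝟙 (x ∈? U))
      ≡⟨ ∑-cong (elements n) (λ x → trans (𝟙-¬ (x ∈? U)) (sym (𝟙-yes ∈⊤ (x ∈? ⊤)))) ⟩
    ∑ (elements n) (λ x → 𝟙 (x ∈? ⊤))
      ≡⟨ trans (∑-card n ⊤) (∣⊤∣≡n n) ⟩
    n ∎
    where open ≡-Reasoning

  subset-induction : ∀ {n ℓ} (P : Subset n → Set ℓ) → P ⊥ → (∀ U x → P U → P (U ∪ ⁅ x ⁆)) → ∀ S → P S
  subset-induction {n} P P⊥ step S = subst P (⊆-antisym (fromList⊆ S) (⊆fromList S)) (onList (listed S))
    where
    fromList : List (Fin n) → Subset n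
    fromList []       = ⊥
    fromList (x ∷ xs) = fromList xs ∪ ⁅ x ⁆
    onList : ∀ xs → P (fromList xs)
    onList []       = P⊥
    onList (x ∷ xs) = step (fromList xs) x (onList xs)
    listed : Subset n → List (Fin n)
    listed Y = filter (_∈? Y) (List.allFin n)
    ∈fromList : ∀ {e} xs → e ∈ˡ xs → e ∈ fromList xs
    ∈fromList (x ∷ xs) (here refl) = q⊆p∪q (fromList xs) ⁅ x ⁆ (x∈⁅x⁆ x)
    ∈fromList (x ∷ xs) (there e∈) = p⊆p∪q ⁅ x ⁆ (∈fromList xs e∈)
    ⊆fromList : ∀ Y → Y ⊆ fromList (listed Y)
    ⊆fromList Y {e} e∈Y = ∈fromList (listed Y) (∈-filter⁺ (_∈? Y) (∈-allFin e) e∈Y)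
    fromList⊆′ : ∀ {Y} xs → (∀ {e} → e ∈ˡ xs → e ∈ Y) → fromList xs ⊆ Y
    fromList⊆′ []       inY e∈ = ⊥-elim (∉⊥ e∈)
    fromList⊆′ (x ∷ xs) inY e∈ with x∈p∪q⁻ (fromList xs) ⁅ x ⁆ e∈
    ... | inj₁ e∈xs = fromList⊆′ xs (λ k → inY (there k)) e∈xs
    ... | inj₂ e∈x rewrite x∈⁅y⁆⇒x≡y _ e∈x = inY (here refl)
    fromList⊆ : ∀ Y → fromList (listed Y) ⊆ Y
    fromList⊆ Y = fromList⊆′ (listed Y) (λ k → proj₂ (∈-filter⁻ (_∈? Y) {xs = List.allFin n} k))

open FiniteSets

module RankFacts {n : ℕ} (M : Matroid n) where

  r : ℕ
  r = rank M

  ρ : Subset n → ℕ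
  ρ = rk M

  ρ-mono : ∀ {X Y} → X ⊆ Y → ρ X ≤ ρ Y
  ρ-mono = rk-mono M

  ρ≤r : ∀ X → ρ X ≤ r
  ρ≤r X = ρ-mono (⊆-max X)

  ρ⊥ : ρ ⊥ ≡ 0
  ρ⊥ = n≤0⇒n≡0 (subst (ρ ⊥ ≤_) (∣⊥∣≡0 n) (rk-card M ⊥))

  ρ-∪⁅⁆ : ∀ U x → ρ (U ∪ ⁅ x ⁆) ≤ suc (ρ U)
  ρ-∪⁅⁆ U x = begin
    ρ (U ∪ ⁅ x ⁆)                 ≤⟨ m≤m+n (ρ (U ∪ ⁅ x ⁆)) (ρ (U ∩ ⁅ x ⁆)) ⟩
    ρ (U ∪ ⁅ x ⁆) + ρ (U ∩ ⁅ x ⁆) ≤⟨ rk-sub M U ⁅ x ⁆ ⟩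
    ρ U + ρ ⁅ x ⁆                 ≤⟨ +-monoʳ-≤ (ρ U) (subst (ρ ⁅ x ⁆ ≤_) (∣⁅x⁆∣≡1 x) (rk-card M ⁅ x ⁆)) ⟩
    ρ U + 1                       ≡⟨ +-comm (ρ U) 1 ⟩
    suc (ρ U)                     ∎
    where open ≤-Reasoning

  -- submodularity: two sets through X that do not raise its rank span nothing new together
  ρ-∪-bound : ∀ X A B → X ⊆ A ∩ B → ρ A ≤ ρ X → ρ B ≤ ρ X → ρ (A ∪ B) ≤ ρ X
  ρ-∪-bound X A B X⊆A∩B ρA≤ ρB≤ = +-cancelʳ-≤ (ρ X) (ρ (A ∪ B)) (ρ X) (begin
    ρ (A ∪ B) + ρ X       ≤⟨ +-monoʳ-≤ (ρ (A ∪ B)) (ρ-mono X⊆A∩B) ⟩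
    ρ (A ∪ B) + ρ (A ∩ B) ≤⟨ rk-sub M A B ⟩
    ρ A + ρ B             ≤⟨ +-mono-≤ ρA≤ ρB≤ ⟩
    ρ X + ρ X             ∎)
    where open ≤-Reasoning

  ρ-∪-span : ∀ X Y → (∀ {e} → e ∈ Y → ρ (X ∪ ⁅ e ⁆) ≤ ρ X) → ρ (X ∪ Y) ≤ ρ X
  ρ-∪-span X Y inSpan = subset-induction (λ Z → Z ⊆ Y → ρ (X ∪ Z) ≤ ρ X) base step Y (λ m → m)
    where
    base : ⊥ ⊆ Y → ρ (X ∪ ⊥) ≤ ρ X
    base _ = ≤-reflexive (cong ρ (∪-identityʳ X))
    step : ∀ U x → (U ⊆ Y → ρ (X ∪ U) ≤ ρ X) → U ∪ ⁅ x ⁆ ⊆ Y → ρ (X ∪ (U ∪ ⁅ x ⁆)) ≤ ρ X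
    step U x ih U+x⊆Y = ≤-trans (ρ-mono regroup)
      (ρ-∪-bound X (X ∪ U) (X ∪ ⁅ x ⁆) (λ m → x∈p∩q⁺ (p⊆p∪q U m , p⊆p∪q ⁅ x ⁆ m))
                 (ih (λ m → U+x⊆Y (p⊆p∪q ⁅ x ⁆ m)))
                 (inSpan (U+x⊆Y (q⊆p∪q U ⁅ x ⁆ (x∈⁅x⁆ x)))))
      where
      regroup : X ∪ (U ∪ ⁅ x ⁆) ⊆ (X ∪ U) ∪ (X ∪ ⁅ x ⁆)
      regroup = ∪-least (λ m → p⊆p∪q _ (p⊆p∪q U m))
                        (∪-least (λ m → p⊆p∪q _ (q⊆p∪q X U m)) (λ m → q⊆p∪q _ _ (q⊆p∪q X ⁅ x ⁆ m)))

  Spanning : Subset n → Set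
  Spanning S = ρ S ≡ r

  spanning? : (S : Subset n) → Dec (Spanning S)
  spanning? S = ρ S ≟ r

  spanning-⊆ : ∀ {U V} → Spanning U → U ⊆ V → Spanning V
  spanning-⊆ {U} {V} spU U⊆V = ≤-antisym (ρ≤r V) (≤-trans (≤-reflexive (sym spU)) (ρ-mono U⊆V))

  no-gain : ∀ U x → suc (ρ U) ≡ r → ¬ Spanning (U ∪ ⁅ x ⁆) → ρ (U ∪ ⁅ x ⁆) ≡ ρ U
  no-gain U x ρU+1≡r ¬sp = ≤-antisym (≤-pred (subst (ρ (U ∪ ⁅ x ⁆) <_) (sym ρU+1≡r) (≤∧≢⇒< (ρ≤r _) ¬sp)))
                                     (ρ-mono (p⊆p∪q ⁅ x ⁆))

  cl : Subset n → Subset n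
  cl S = tabulate (λ e → does (ρ (S ∪ ⁅ e ⁆) ≟ ρ S))

  cl-∈⁻ : ∀ {S e} → e ∈ cl S → ρ (S ∪ ⁅ e ⁆) ≡ ρ S
  cl-∈⁻ {S} {e} e∈ = reflected (ρ (S ∪ ⁅ e ⁆) ≟ ρ S)
    (trans (sym ([]=⇒lookup e∈)) (lookup∘tabulate (λ e → does (ρ (S ∪ ⁅ e ⁆) ≟ ρ S)) e))
    where
    reflected : (d : Dec (ρ (S ∪ ⁅ e ⁆) ≡ ρ S)) → true ≡ does d → ρ (S ∪ ⁅ e ⁆) ≡ ρ S
    reflected (yes p) _ = p
    reflected (no _)  ()

  cl-∈⁺ : ∀ {S e} → ρ (S ∪ ⁅ e ⁆) ≡ ρ S → e ∈ cl S
  cl-∈⁺ {S} {e} p = lookup⇒[]= e (cl S)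
    (trans (lookup∘tabulate (λ e → does (ρ (S ∪ ⁅ e ⁆) ≟ ρ S)) e) (decided (ρ (S ∪ ⁅ e ⁆) ≟ ρ S)))
    where
    decided : (d : Dec (ρ (S ∪ ⁅ e ⁆) ≡ ρ S)) → does d ≡ true
    decided (yes _) = refl
    decided (no ¬p) = ⊥-elim (¬p p)

  ⊆cl : ∀ S → S ⊆ cl S
  ⊆cl S e∈S = cl-∈⁺ (cong ρ (∪⁅⁆-∈ e∈S))

  ρ-cl : ∀ S → ρ (cl S) ≡ ρ S
  ρ-cl S = ≤-antisym (≤-trans (ρ-mono (q⊆p∪q S (cl S))) (ρ-∪-span S (cl S) (λ m → ≤-reflexive (cl-∈⁻ m))))
                     (ρ-mono (⊆cl S))

  cl-flat : ∀ S → Flat M (cl S)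
  cl-flat S e e∉ = begin-strict
    ρ (cl S)         ≡⟨ ρ-cl S ⟩
    ρ S              <⟨ ≤∧≢⇒< (ρ-mono (p⊆p∪q ⁅ e ⁆)) (λ eq → e∉ (cl-∈⁺ (sym eq))) ⟩
    ρ (S ∪ ⁅ e ⁆)    ≤⟨ ρ-mono (∪-least (λ m → p⊆p∪q _ (⊆cl S m)) (q⊆p∪q _ _)) ⟩
    ρ (cl S ∪ ⁅ e ⁆) ∎
    where open ≤-Reasoning

  cl-nontrivial : ∀ S → suc (ρ S) ≡ r → r ≤ ∣ S ∣ → NontrivialCopoint M (cl S)
  cl-nontrivial S ρS+1≡r r≤∣S∣ =
    (cl-flat S , trans (cong suc (ρ-cl S)) ρS+1≡r) , ≤-trans r≤∣S∣ (p⊆q⇒∣p∣≤∣q∣ (⊆cl S))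

  copoint-unique : ∀ S H → suc (ρ S) ≡ r → Copoint M H → S ⊆ H → H ≡ cl S
  copoint-unique S H ρS+1≡r (flatH , ρH+1≡r) S⊆H = ⊆-antisym H⊆cl cl⊆H
    where
    ρH≡ρS : ρ H ≡ ρ S
    ρH≡ρS = suc-injective (trans ρH+1≡r (sym ρS+1≡r))
    H⊆cl : H ⊆ cl S
    H⊆cl {e} e∈H = cl-∈⁺ (≤-antisym (≤-trans (ρ-mono (∪-least S⊆H (⁅⁆⊆ e∈H))) (≤-reflexive ρH≡ρS))
                                     (ρ-mono (p⊆p∪q ⁅ e ⁆)))
    cl⊆H : cl S ⊆ H
    cl⊆H {e} e∈cl with e ∈? H
    ... | yes e∈H = e∈H
    ... | no e∉H  = ⊥-elim (<-irrefl refl (<-≤-trans (flatH e e∉H) noGain))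
      where
      -- H and S ∪ {e} both have the rank of S, so their union (⊇ H ∪ {e}) does too
      noGain : ρ (H ∪ ⁅ e ⁆) ≤ ρ H
      noGain = ≤-trans (ρ-mono (∪-least (p⊆p∪q _) (λ m → q⊆p∪q H _ (q⊆p∪q S _ m))))
        (≤-trans (ρ-∪-bound S H (S ∪ ⁅ e ⁆) (λ m → x∈p∩q⁺ (S⊆H m , p⊆p∪q _ m))
                            (≤-reflexive ρH≡ρS) (≤-reflexive (cl-∈⁻ e∈cl)))
                 (≤-reflexive (sym ρH≡ρS)))

  basis-spanning : ∀ X → Basis M X → Spanning X
  basis-spanning X (indep , maximal) =
    ≤-antisym (ρ≤r X) (≤-trans (ρ-mono (q⊆p∪q X ⊤)) (ρ-∪-span X ⊤ noGain))
    where
    noGain : ∀ {e} → e ∈ ⊤ → ρ (X ∪ ⁅ e ⁆) ≤ ρ X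
    noGain {e} _ with e ∈? X
    ... | yes e∈X = ≤-reflexive (cong ρ (∪⁅⁆-∈ e∈X))
    ... | no e∉X  = subst (ρ (X ∪ ⁅ e ⁆) ≤_) (sym indep)
        (≤-pred (≤∧≢⇒< (subst (ρ (X ∪ ⁅ e ⁆) ≤_) (cong suc indep) (ρ-∪⁅⁆ X e))
                       (λ eq → maximal e e∉X (trans eq (sym (∣∪⁅⁆∣ e X e∉X))))))

-- Paving matroids.  All sets with fewer than r elements are independent, so
-- every set S is of one of three kinds: spanning; independent with at most
-- r - 2 elements; or of rank r - 1 with at least r - 1 elements.

module PavingFacts {n : ℕ} (M : Matroid n) (paving : Paving M) where

  open RankFacts M

  small-independent : ∀ S → ∣ S ∣ < r → Independent M S
  small-independent S = go ∣ S ∣ S ≤-refl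
    where
    -- induction on an upper bound for ∣ S ∣: a minimal dependent subset would be a small circuit
    go : ∀ bound S → ∣ S ∣ ≤ bound → ∣ S ∣ < r → Independent M S
    go bound S ∣S∣≤ ∣S∣<r with independent? M S
    ... | yes indep = indep
    ... | no dep with anySubset? (λ D → (D ⊂? S) ×-dec ¬? (independent? M D))
    ...   | yes (D , D⊂S , depD) = ⊥-elim (depD (smaller bound ∣S∣≤ (p⊂q⇒∣p∣<∣q∣ D⊂S)))
      where
      smaller : ∀ bound → ∣ S ∣ ≤ bound → ∣ D ∣ < ∣ S ∣ → Independent M D
      smaller zero      ∣S∣≤ ∣D∣< = ⊥-elim (n≮0 (≤-trans ∣D∣< ∣S∣≤))
      smaller (suc b)   ∣S∣≤ ∣D∣< = go b D (≤-pred (≤-trans ∣D∣< ∣S∣≤)) (<-trans ∣D∣< ∣S∣<r)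
    ...   | no noneDep = ⊥-elim (tooSmall (paving S (dep , minimal)))
      where
      minimal : ∀ D → D ⊂ S → Independent M D
      minimal D D⊂S with independent? M D
      ... | yes indep = indep
      ... | no depD   = ⊥-elim (noneDep (D , D⊂S , depD))
      tooSmall : ¬ (∣ S ∣ ≡ r ⊎ ∣ S ∣ ≡ suc r)
      tooSmall (inj₁ e) = <-irrefl e ∣S∣<r
      tooSmall (inj₂ e) = <-irrefl refl (<-trans (subst (_< r) e ∣S∣<r) (n<1+n r))

  data Profile (S : Subset n) : Set where
    spanning    : Spanning S → Profile S
    free        : ρ S ≡ ∣ S ∣ → suc ∣ S ∣ < r → Profile S
    nonspanning : suc (ρ S) ≡ r → r ≤ suc ∣ S ∣ → Profile S

  profile-⊥ : Profile ⊥
  profile-⊥ with 1 <? r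
  ... | yes 1<r = free (trans ρ⊥ (sym (∣⊥∣≡0 n))) (subst (λ k → suc k < r) (sym (∣⊥∣≡0 n)) 1<r)
  ... | no 1≮r with r ≟ 0
  ...   | yes r≡0 = spanning (trans ρ⊥ (sym r≡0))
  ...   | no r≢0  = nonspanning (trans (cong suc ρ⊥) (≤-antisym (n≢0⇒n>0 r≢0) (≮⇒≥ 1≮r)))
                                (subst (λ k → r ≤ suc k) (sym (∣⊥∣≡0 n)) (≮⇒≥ 1≮r))

  profile-∪⁅⁆ : ∀ U x → Profile U → Profile (U ∪ ⁅ x ⁆)
  profile-∪⁅⁆ U x p with x ∈? U
  ... | yes x∈U rewrite ∪⁅⁆-∈ x∈U = p
  ... | no x∉U  = grow p
    where
    ∣U+x∣ : ∣ U ∪ ⁅ x ⁆ ∣ ≡ suc ∣ U ∣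
    ∣U+x∣ = ∣∪⁅⁆∣ x U x∉U
    grow : Profile U → Profile (U ∪ ⁅ x ⁆)
    grow (spanning spU) = spanning (spanning-⊆ spU (p⊆p∪q ⁅ x ⁆))
    grow (free _ ∣U∣+1<r) with suc (suc ∣ U ∣) <? r
    ... | yes ∣U∣+2<r = free (small-independent _ (subst (_< r) (sym ∣U+x∣) ∣U∣+1<r))
                             (subst (λ k → suc k < r) (sym ∣U+x∣) ∣U∣+2<r)
    ... | no ∣U∣+2≮r  = nonspanning
      (trans (cong suc (trans (small-independent _ (subst (_< r) (sym ∣U+x∣) ∣U∣+1<r)) ∣U+x∣))
             (≤-antisym ∣U∣+1<r (≮⇒≥ ∣U∣+2≮r)))
      (subst (λ k → r ≤ suc k) (sym ∣U+x∣) (≮⇒≥ ∣U∣+2≮r))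
    grow (nonspanning ρU+1≡r r≤) with spanning? (U ∪ ⁅ x ⁆)
    ... | yes sp  = spanning sp
    ... | no ¬sp  = nonspanning (trans (cong suc (no-gain U x ρU+1≡r ¬sp)) ρU+1≡r)
                                (subst (λ k → r ≤ suc k) (sym ∣U+x∣) (≤-trans r≤ (n≤1+n _)))

  profile : ∀ S → Profile S
  profile = subset-induction Profile profile-⊥ profile-∪⁅⁆

  nonspanning⇔corank1 : ∀ S → r ≤ ∣ S ∣ → 𝟙 (¬? (spanning? S)) ≡ 𝟙 (suc (ρ S) ≟ r)
  nonspanning⇔corank1 S r≤∣S∣ with profile S
  ... | spanning spS = trans (𝟙-no (λ ¬sp → ¬sp spS) (¬? (spanning? S)))
                             (sym (𝟙-no (λ ρS+1≡r → 1+n≢n (trans ρS+1≡r (sym spS))) (suc (ρ S) ≟ r)))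
  ... | free _ ∣S∣+1<r = ⊥-elim (<-irrefl refl (<-≤-trans ∣S∣+1<r (≤-trans r≤∣S∣ (n≤1+n _))))
  ... | nonspanning ρS+1≡r _ = trans (𝟙-yes (λ spS → 1+n≢n (trans ρS+1≡r (sym spS))) (¬? (spanning? S)))
                                     (sym (𝟙-yes ρS+1≡r (suc (ρ S) ≟ r)))

  increment-spanning : ∀ U x → ¬ Spanning U → Spanning (U ∪ ⁅ x ⁆) → ρ (U ∪ ⁅ x ⁆) ∸ ρ U ≡ 1
  increment-spanning U x ¬spU spU+x with profile U
  ... | spanning spU = ⊥-elim (¬spU spU)
  ... | free ρU≡∣U∣ ∣U∣+1<r = ⊥-elim (<-irrefl spU+x (≤-<-trans ρU+x≤ ∣U∣+1<r))
    where
    ρU+x≤ : ρ (U ∪ ⁅ x ⁆) ≤ suc ∣ U ∣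
    ρU+x≤ = ≤-trans (ρ-∪⁅⁆ U x) (≤-reflexive (cong suc ρU≡∣U∣))
  ... | nonspanning ρU+1≡r _ = trans (cong (_∸ ρ U) (trans spU+x (sym ρU+1≡r))) (m+n∸n≡m 1 (ρ U))

  increment-nonspanning : ∀ U x → x ∉ U → ¬ Spanning (U ∪ ⁅ x ⁆) → ρ (U ∪ ⁅ x ⁆) ∸ ρ U ≡ 𝟙 (suc ∣ U ∣ <? r)
  increment-nonspanning U x x∉U ¬spU+x with profile U
  ... | spanning spU = ⊥-elim (¬spU+x (spanning-⊆ spU (p⊆p∪q ⁅ x ⁆)))
  ... | free ρU≡∣U∣ ∣U∣+1<r = begin
    ρ (U ∪ ⁅ x ⁆) ∸ ρ U  ≡⟨ cong₂ _∸_ (trans (small-independent _ (subst (_< r) (sym ∣U+x∣) ∣U∣+1<r)) ∣U+x∣) ρU≡∣U∣ ⟩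
    suc ∣ U ∣ ∸ ∣ U ∣    ≡⟨ m+n∸n≡m 1 ∣ U ∣ ⟩
    1                    ≡⟨ sym (𝟙-yes ∣U∣+1<r (suc ∣ U ∣ <? r)) ⟩
    𝟙 (suc ∣ U ∣ <? r)   ∎
    where
    open ≡-Reasoning
    ∣U+x∣ : ∣ U ∪ ⁅ x ⁆ ∣ ≡ suc ∣ U ∣
    ∣U+x∣ = ∣∪⁅⁆∣ x U x∉U
  ... | nonspanning ρU+1≡r r≤∣U∣+1 = begin
    ρ (U ∪ ⁅ x ⁆) ∸ ρ U  ≡⟨ cong (_∸ ρ U) (no-gain U x ρU+1≡r ¬spU+x) ⟩
    ρ U ∸ ρ U            ≡⟨ n∸n≡0 (ρ U) ⟩
    0                    ≡⟨ sym (𝟙-no (λ ∣U∣+1<r → <-irrefl refl (<-≤-trans ∣U∣+1<r r≤∣U∣+1)) (suc ∣ U ∣ <? r)) ⟩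
    𝟙 (suc ∣ U ∣ <? r)   ∎
    where open ≡-Reasoning

-- Arrangements.  More
-- generally, a vector v of length k "completes" U if it lists every element
-- outside U; when ∣ U ∣ + k = n its entries are then distinct and outside U.

module Arrangements (n : ℕ) where

  Completes : ∀ {k} → Subset n → Vec (Fin n) k → Set
  Completes U v = ∀ i → i ∉ U → i ∈ᵥ v

  completes? : ∀ {k} (U : Subset n) (v : Vec (Fin n) k) → Dec (Completes U v)
  completes? U v = FinP.all? (λ i → ¬? (i ∈? U) →-dec VecDec._∈?_ FinP._≟_ i v)

  vectors : (k : ℕ) → List (Vec (Fin n) k)
  vectors k = allVecs (elements n) k

  permutation⇔completes⊥ : (v : Vec (Fin n) n) → 𝟙 (isPerm? v) ≡ 𝟙 (completes? ⊥ v)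
  permutation⇔completes⊥ v = 𝟙-⇔ (isPerm? v) (completes? ⊥ v) (λ perm i _ → perm i) (λ c i → c i ∉⊥)

  completes-tail : ∀ {k} {U x} {v : Vec (Fin n) k} → Completes U (x ∷ v) → Completes (U ∪ ⁅ x ⁆) v
  completes-tail {U = U} {x} c i i∉ with c i (λ m → i∉ (p⊆p∪q ⁅ x ⁆ m))
  ... | here refl = ⊥-elim (i∉ (q⊆p∪q U ⁅ x ⁆ (x∈⁅x⁆ x)))
  ... | there m   = m

  completes-cons : ∀ {k} {U x} {v : Vec (Fin n) k} → Completes (U ∪ ⁅ x ⁆) v → Completes U (x ∷ v)
  completes-cons {U = U} {x} c i i∉U with i FinP.≟ x
  ... | yes refl = here refl
  ... | no i≢x   = there (c i (λ m → [ i∉U , (λ i∈x → i≢x (x∈⁅y⁆⇒x≡y x i∈x)) ]′ (x∈p∪q⁻ U ⁅ x ⁆ m)))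

  completes-[] : ∀ {U} → Completes U [] → ⊤ ⊆ U
  completes-[] {U} c {i} _ with i ∈? U
  ... | yes i∈U = i∈U
  ... | no i∉U with c i i∉U
  ...   | ()

  completes-size : ∀ {k} U (v : Vec (Fin n) k) → Completes U v → n ≤ ∣ U ∣ + k
  completes-size U [] c = begin
    n           ≡⟨ sym (∣⊤∣≡n n) ⟩
    ∣ ⊤ {n} ∣   ≤⟨ p⊆q⇒∣p∣≤∣q∣ (completes-[] c) ⟩
    ∣ U ∣       ≡⟨ sym (+-identityʳ _) ⟩
    ∣ U ∣ + 0   ∎
    where open ≤-Reasoning
  completes-size {suc k} U (x ∷ v) c = begin
    n                    ≤⟨ completes-size (U ∪ ⁅ x ⁆) v (completes-tail c) ⟩
    ∣ U ∪ ⁅ x ⁆ ∣ + k    ≤⟨ +-monoˡ-≤ k ∣U+x∣≤ ⟩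
    suc ∣ U ∣ + k        ≡⟨ sym (+-suc ∣ U ∣ k) ⟩
    ∣ U ∣ + suc k        ∎
    where
    open ≤-Reasoning
    ∣U+x∣≤ : ∣ U ∪ ⁅ x ⁆ ∣ ≤ suc ∣ U ∣
    ∣U+x∣≤ with x ∈? U
    ... | yes x∈U rewrite ∪⁅⁆-∈ x∈U = n≤1+n _
    ... | no x∉U  = ≤-reflexive (∣∪⁅⁆∣ x U x∉U)

  completes-head : ∀ {k} {U x} {v : Vec (Fin n) k} → ∣ U ∣ + suc k ≡ n → Completes U (x ∷ v) → x ∉ U
  completes-head {k} {U} {x} {v} tight c x∈U =
    1+n≰n (subst (_≤ ∣ U ∣ + k) (trans (sym tight) (+-suc ∣ U ∣ k)) (completes-size U v c′))
    where
    c′ : Completes U v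
    c′ i i∉U with c i i∉U
    ... | here refl = ⊥-elim (i∉U x∈U)
    ... | there m   = m

  tight-step : ∀ {k} (U : Subset n) (x : Fin n) → x ∉ U → ∣ U ∣ + suc k ≡ n → ∣ U ∪ ⁅ x ⁆ ∣ + k ≡ n
  tight-step {k} U x x∉U tight = trans (cong (_+ k) (∣∪⁅⁆∣ x U x∉U)) (trans (sym (+-suc ∣ U ∣ k)) tight)

  ∑-completions-suc : ∀ k (U : Subset n) → ∣ U ∣ + suc k ≡ n → (F : Vec (Fin n) (suc k) → ℕ) →
    ∑ (vectors (suc k)) (λ v → 𝟙 (completes? U v) * F v) ≡
    ∑ (elements n) (λ x → 𝟙 (¬? (x ∈? U)) * ∑ (vectors k) (λ v → 𝟙 (completes? (U ∪ ⁅ x ⁆) v) * F (x ∷ v)))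
  ∑-completions-suc k U tight F = begin
    ∑ (vectors (suc k)) (λ v → 𝟙 (completes? U v) * F v)
      ≡⟨ ∑-concatMap (λ x → map (x ∷_) (vectors k)) (elements n) _ ⟩
    ∑ (elements n) (λ x → ∑ (map (x ∷_) (vectors k)) (λ v → 𝟙 (completes? U v) * F v))
      ≡⟨ ∑-cong (elements n) (λ x → trans (∑-map (x ∷_) (vectors k) _)
           (trans (∑-cong (vectors k) (peel x)) (∑-*ˡ (vectors k) (𝟙 (¬? (x ∈? U))) _))) ⟩
    ∑ (elements n) (λ x → 𝟙 (¬? (x ∈? U)) * ∑ (vectors k) (λ v → 𝟙 (completes? (U ∪ ⁅ x ⁆) v) * F (x ∷ v))) ∎
    where
    open ≡-Reasoning
    peel : ∀ x v → 𝟙 (completes? U (x ∷ v)) * F (x ∷ v) ≡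
                   𝟙 (¬? (x ∈? U)) * (𝟙 (completes? (U ∪ ⁅ x ⁆) v) * F (x ∷ v))
    peel x v = trans (cong (_* F (x ∷ v))
                 (trans (𝟙-⇔ (completes? U (x ∷ v)) (¬? (x ∈? U) ×-dec completes? (U ∪ ⁅ x ⁆) v)
                             (λ c → completes-head tight c , completes-tail c) (λ p → completes-cons (proj₂ p)))
                        (𝟙-× (¬? (x ∈? U)) (completes? (U ∪ ⁅ x ⁆) v))))
               (*-assoc (𝟙 (¬? (x ∈? U))) (𝟙 (completes? (U ∪ ⁅ x ⁆) v)) (F (x ∷ v)))

  #completions : ∀ k (U : Subset n) → ∣ U ∣ + k ≡ n → ∑ (vectors k) (λ v → 𝟙 (completes? U v) * 1) ≡ k !
  #completions zero U tight = cong (_+ 0) (cong (_* 1) (𝟙-yes complete (completes? U [])))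
    where
    complete : Completes U []
    complete i i∉U = ⊥-elim (i∉U (subst (i ∈_) (sym (∣p∣≡n⇒p≡⊤ (trans (sym (+-identityʳ _)) tight))) ∈⊤))
  #completions (suc k) U tight = begin
    ∑ (vectors (suc k)) (λ v → 𝟙 (completes? U v) * 1)
      ≡⟨ ∑-completions-suc k U tight (λ _ → 1) ⟩
    ∑ (elements n) (λ x → 𝟙 (¬? (x ∈? U)) * ∑ (vectors k) (λ v → 𝟙 (completes? (U ∪ ⁅ x ⁆) v) * 1))
      ≡⟨ ∑-cong (elements n) (λ x → 𝟙-guard (¬? (x ∈? U)) (λ x∉U → #completions k (U ∪ ⁅ x ⁆) (tight-step U x x∉U tight))) ⟩
    ∑ (elements n) (λ x → 𝟙 (¬? (x ∈? U)) * k !)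
      ≡⟨ trans (∑-cong (elements n) (λ x → *-comm _ (k !))) (∑-*ˡ (elements n) (k !) _) ⟩
    k ! * ∑ (elements n) (λ x → 𝟙 (¬? (x ∈? U)))
      ≡⟨ cong (k ! *_) #choices ⟩
    k ! * suc k
      ≡⟨ *-comm (k !) (suc k) ⟩
    suc k ! ∎
    where
    open ≡-Reasoning
    #choices : ∑ (elements n) (λ x → 𝟙 (¬? (x ∈? U))) ≡ suc k
    #choices = +-cancelʳ-≡ _ _ _ (trans (#outside n U) (trans (sym tight) (+-comm ∣ U ∣ (suc k))))

  prefix : ∀ {k} → ℕ → Vec (Fin n) k → Subset n
  prefix zero    v       = ⊥
  prefix (suc j) []      = ⊥
  prefix (suc j) (x ∷ v) = ⁅ x ⁆ ∪ prefix j v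

  ∑⊇ : Subset n → ℕ → (Subset n → ℕ) → ℕ
  ∑⊇ U m q = ∑ (allSubsets n) (λ S → 𝟙 (U ⊆? S) * (𝟙 (∣ S ∣ ≟ m) * q S))

  ∑⊇-self : ∀ U q → ∑⊇ U (∣ U ∣ + 0) q ≡ q U
  ∑⊇-self U q = trans (∑-cong (allSubsets n) onlyU) (∑-point n U q)
    where
    onlyU : ∀ S → 𝟙 (U ⊆? S) * (𝟙 (∣ S ∣ ≟ ∣ U ∣ + 0) * q S) ≡ 𝟙 (U ≟S S) * q S
    onlyU S = trans (sym (*-assoc (𝟙 (U ⊆? S)) _ (q S)))
      (cong (_* q S) (trans (sym (𝟙-× (U ⊆? S) (∣ S ∣ ≟ ∣ U ∣ + 0)))
      (𝟙-⇔ (U ⊆? S ×-dec (∣ S ∣ ≟ ∣ U ∣ + 0)) (U ≟S S)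
           (λ (U⊆S , ∣S∣≡) → ⊆-card-eq U S U⊆S (trans (sym (+-identityʳ _)) (sym ∣S∣≡)))
           (λ { refl → (λ m → m) , sym (+-identityʳ _) }))))

  ∑⊇-⊥ : ∀ m q → ∑⊇ ⊥ m q ≡ ∑ (allSubsets n) (λ S → 𝟙 (∣ S ∣ ≟ m) * q S)
  ∑⊇-⊥ m q = ∑-cong (allSubsets n) (λ S →
    trans (cong (_* (𝟙 (∣ S ∣ ≟ m) * q S)) (𝟙-yes (λ {x} x∈⊥ → ⊥⊆ {x = x} x∈⊥) (⊥ ⊆? S))) (+-identityʳ _))

  #one-more : ∀ U S → U ⊆ S → ∑ (elements n) (λ x → 𝟙 (¬? (x ∈? U)) * 𝟙 (x ∈? S)) + ∣ U ∣ ≡ ∣ S ∣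
  #one-more U S U⊆S = begin
    ∑ (elements n) (λ x → 𝟙 (¬? (x ∈? U)) * 𝟙 (x ∈? S)) + ∣ U ∣
      ≡⟨ cong (∑ (elements n) (λ x → 𝟙 (¬? (x ∈? U)) * 𝟙 (x ∈? S)) +_) (sym (∑-card n U)) ⟩
    ∑ (elements n) (λ x → 𝟙 (¬? (x ∈? U)) * 𝟙 (x ∈? S)) + ∑ (elements n) (λ x → 𝟙 (x ∈? U))
      ≡⟨ sym (∑-+ (elements n) _ _) ⟩
    ∑ (elements n) (λ x → 𝟙 (¬? (x ∈? U)) * 𝟙 (x ∈? S) + 𝟙 (x ∈? U))
      ≡⟨ ∑-cong (elements n) pointwise ⟩
    ∑ (elements n) (λ x → 𝟙 (x ∈? S))
      ≡⟨ ∑-card n S ⟩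
    ∣ S ∣ ∎
    where
    open ≡-Reasoning
    pointwise : ∀ x → 𝟙 (¬? (x ∈? U)) * 𝟙 (x ∈? S) + 𝟙 (x ∈? U) ≡ 𝟙 (x ∈? S)
    pointwise x with x ∈? U
    ... | yes x∈U rewrite 𝟙-yes (U⊆S x∈U) (x ∈? S) = refl
    ... | no _    = trans (+-identityʳ _) (+-identityʳ _)

  -- double counting the pairs (x, S) with x ∉ U and U ∪ {x} ⊆ S, ∣ S ∣ = ∣ U ∣ + suc j:
  -- each such S arises from exactly suc j elements x
  ∑-one-more : ∀ U j q → ∑ (elements n) (λ x → 𝟙 (¬? (x ∈? U)) * ∑⊇ (U ∪ ⁅ x ⁆) (∣ U ∣ + suc j) q)
                         ≡ suc j * ∑⊇ U (∣ U ∣ + suc j) q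
  ∑-one-more U j q = begin
    ∑ (elements n) (λ x → 𝟙 (¬? (x ∈? U)) * ∑⊇ (U ∪ ⁅ x ⁆) N q)
      ≡⟨ ∑-cong (elements n) (λ x → sym (∑-*ˡ (allSubsets n) (𝟙 (¬? (x ∈? U))) _)) ⟩
    ∑ (elements n) (λ x → ∑ (allSubsets n) (λ S → 𝟙 (¬? (x ∈? U)) * term (U ∪ ⁅ x ⁆) S))
      ≡⟨ ∑-swap (elements n) (allSubsets n) _ ⟩
    ∑ (allSubsets n) (λ S → ∑ (elements n) (λ x → 𝟙 (¬? (x ∈? U)) * term (U ∪ ⁅ x ⁆) S))
      ≡⟨ ∑-cong (allSubsets n) at ⟩
    ∑ (allSubsets n) (λ S → suc j * term U S)
      ≡⟨ ∑-*ˡ (allSubsets n) (suc j) _ ⟩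
    suc j * ∑⊇ U N q ∎
    where
    open ≡-Reasoning
    N : ℕ
    N = ∣ U ∣ + suc j
    term : Subset n → Subset n → ℕ
    term V S = 𝟙 (V ⊆? S) * (𝟙 (∣ S ∣ ≟ N) * q S)
    at : ∀ S → ∑ (elements n) (λ x → 𝟙 (¬? (x ∈? U)) * term (U ∪ ⁅ x ⁆) S) ≡ suc j * term U S
    at S with U ⊆? S
    ... | no U⊈S = trans (∑-zero (elements n) vanish) (sym (*-zeroʳ (suc j)))
      where
      vanish : ∀ x → 𝟙 (¬? (x ∈? U)) * term (U ∪ ⁅ x ⁆) S ≡ 0
      vanish x rewrite 𝟙-no (λ U+x⊆S → U⊈S (λ m → U+x⊆S (p⊆p∪q ⁅ x ⁆ m))) ((U ∪ ⁅ x ⁆) ⊆? S) =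
        *-zeroʳ (𝟙 (¬? (x ∈? U)))
    ... | yes U⊆S with ∣ S ∣ ≟ N
    ...   | no _ = trans (∑-zero (elements n) vanish) (sym (*-zeroʳ (suc j)))
      where
      vanish : ∀ x → 𝟙 (¬? (x ∈? U)) * (𝟙 ((U ∪ ⁅ x ⁆) ⊆? S) * (0 * q S)) ≡ 0
      vanish x = trans (cong (𝟙 (¬? (x ∈? U)) *_) (*-zeroʳ (𝟙 ((U ∪ ⁅ x ⁆) ⊆? S)))) (*-zeroʳ (𝟙 (¬? (x ∈? U))))
    ...   | yes ∣S∣≡N = begin
      ∑ (elements n) (λ x → 𝟙 (¬? (x ∈? U)) * (𝟙 ((U ∪ ⁅ x ⁆) ⊆? S) * (1 * q S)))
        ≡⟨ ∑-cong (elements n) (λ x → cong (λ t → 𝟙 (¬? (x ∈? U)) * (t * (1 * q S)))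
             (𝟙-⇔ ((U ∪ ⁅ x ⁆) ⊆? S) (x ∈? S) (λ U+x⊆S → U+x⊆S (q⊆p∪q U ⁅ x ⁆ (x∈⁅x⁆ x)))
                                            (λ x∈S → ∪-least U⊆S (⁅⁆⊆ x∈S)))) ⟩
      ∑ (elements n) (λ x → 𝟙 (¬? (x ∈? U)) * (𝟙 (x ∈? S) * (1 * q S)))
        ≡⟨ ∑-cong (elements n) (λ x → solve 3 (λ a b c → a :* (b :* (con 1 :* c)) := c :* (a :* b)) refl
             (𝟙 (¬? (x ∈? U))) (𝟙 (x ∈? S)) (q S)) ⟩
      ∑ (elements n) (λ x → q S * (𝟙 (¬? (x ∈? U)) * 𝟙 (x ∈? S)))
        ≡⟨ ∑-*ˡ (elements n) (q S) _ ⟩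
      q S * ∑ (elements n) (λ x → 𝟙 (¬? (x ∈? U)) * 𝟙 (x ∈? S))
        ≡⟨ cong (q S *_) (+-cancelʳ-≡ ∣ U ∣ _ _ (trans (#one-more U S U⊆S) (trans ∣S∣≡N (+-comm ∣ U ∣ (suc j))))) ⟩
      q S * suc j
        ≡⟨ solve 2 (λ a b → a :* b := b :* (con 1 :* (con 1 :* a))) refl (q S) (suc j) ⟩
      suc j * (1 * (1 * q S)) ∎

  ∑-prefixes : ∀ j k (U : Subset n) → ∣ U ∣ + k ≡ n → j ≤ k → (q : Subset n → ℕ) →
    ∑ (vectors k) (λ v → 𝟙 (completes? U v) * q (U ∪ prefix j v)) ≡ j ! * (k ∸ j) ! * ∑⊇ U (∣ U ∣ + j) q
  ∑-prefixes zero k U tight _ q = begin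
    ∑ (vectors k) (λ v → 𝟙 (completes? U v) * q (U ∪ ⊥))
      ≡⟨ ∑-cong (vectors k) (λ v → solve 2 (λ a b → a :* b := b :* (a :* con 1)) refl (𝟙 (completes? U v)) (q (U ∪ ⊥))) ⟩
    ∑ (vectors k) (λ v → q (U ∪ ⊥) * (𝟙 (completes? U v) * 1))
      ≡⟨ ∑-*ˡ (vectors k) (q (U ∪ ⊥)) _ ⟩
    q (U ∪ ⊥) * ∑ (vectors k) (λ v → 𝟙 (completes? U v) * 1)
      ≡⟨ cong₂ _*_ (cong q (∪-identityʳ U)) (#completions k U tight) ⟩
    q U * k !
      ≡⟨ cong₂ _*_ (sym (∑⊇-self U q)) (sym (+-identityʳ (k !))) ⟩
    ∑⊇ U (∣ U ∣ + 0) q * (k ! + 0)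
      ≡⟨ *-comm _ (k ! + 0) ⟩
    0 ! * (k ∸ 0) ! * ∑⊇ U (∣ U ∣ + 0) q ∎
    where open ≡-Reasoning
  ∑-prefixes (suc j) (suc k) U tight (s≤s j≤k) q = begin
    ∑ (vectors (suc k)) (λ v → 𝟙 (completes? U v) * q (U ∪ prefix (suc j) v))
      ≡⟨ ∑-completions-suc k U tight (λ v → q (U ∪ prefix (suc j) v)) ⟩
    ∑ (elements n) (λ x → 𝟙 (¬? (x ∈? U)) * ∑ (vectors k) (λ v → 𝟙 (completes? (U ∪ ⁅ x ⁆) v) * q (U ∪ (⁅ x ⁆ ∪ prefix j v))))
      ≡⟨ ∑-cong (elements n) (λ x → 𝟙-guard (¬? (x ∈? U)) (λ x∉U → afterFirst x x∉U)) ⟩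
    ∑ (elements n) (λ x → 𝟙 (¬? (x ∈? U)) * (K * ∑⊇ (U ∪ ⁅ x ⁆) N q))
      ≡⟨ ∑-cong (elements n) (λ x → solve 3 (λ a b c → a :* (b :* c) := b :* (a :* c)) refl (𝟙 (¬? (x ∈? U))) K _) ⟩
    ∑ (elements n) (λ x → K * (𝟙 (¬? (x ∈? U)) * ∑⊇ (U ∪ ⁅ x ⁆) N q))
      ≡⟨ ∑-*ˡ (elements n) K _ ⟩
    K * ∑ (elements n) (λ x → 𝟙 (¬? (x ∈? U)) * ∑⊇ (U ∪ ⁅ x ⁆) N q)
      ≡⟨ cong (K *_) (∑-one-more U j q) ⟩
    K * (suc j * ∑⊇ U N q)
      ≡⟨ solve 4 (λ a b c d → a :* b :* (c :* d) := c :* a :* b :* d) refl (j !) ((k ∸ j) !) (suc j) (∑⊇ U N q) ⟩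
    suc j ! * (suc k ∸ suc j) ! * ∑⊇ U N q ∎
    where
    open ≡-Reasoning
    N : ℕ
    N = ∣ U ∣ + suc j
    K : ℕ
    K = j ! * (k ∸ j) !
    afterFirst : ∀ x → x ∉ U →
      ∑ (vectors k) (λ v → 𝟙 (completes? (U ∪ ⁅ x ⁆) v) * q (U ∪ (⁅ x ⁆ ∪ prefix j v))) ≡ K * ∑⊇ (U ∪ ⁅ x ⁆) N q
    afterFirst x x∉U = begin
      ∑ (vectors k) (λ v → 𝟙 (completes? (U ∪ ⁅ x ⁆) v) * q (U ∪ (⁅ x ⁆ ∪ prefix j v)))
        ≡⟨ ∑-cong (vectors k) (λ v → cong (λ T → 𝟙 (completes? (U ∪ ⁅ x ⁆) v) * q T) (sym (∪-assoc U ⁅ x ⁆ (prefix j v)))) ⟩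
      ∑ (vectors k) (λ v → 𝟙 (completes? (U ∪ ⁅ x ⁆) v) * q ((U ∪ ⁅ x ⁆) ∪ prefix j v))
        ≡⟨ ∑-prefixes j k (U ∪ ⁅ x ⁆) (tight-step U x x∉U tight) j≤k q ⟩
      K * ∑⊇ (U ∪ ⁅ x ⁆) (∣ U ∪ ⁅ x ⁆ ∣ + j) q
        ≡⟨ cong (λ m → K * ∑⊇ (U ∪ ⁅ x ⁆) m q) (trans (cong (_+ j) (∣∪⁅⁆∣ x U x∉U)) (sym (+-suc ∣ U ∣ j))) ⟩
      K * ∑⊇ (U ∪ ⁅ x ⁆) N q ∎

-- The rank sequence of a paving matroid.  Along an arrangement, the rank grows
-- by one at each step while fewer than r - 1 elements have been placed, then
-- stays at r - 1 until the placed set first spans, where it grows by one more,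
-- and is constant afterwards.

_≟ᵥ_ : ∀ {k} (s s′ : Vec ℕ k) → Dec (s ≡ s′)
_≟ᵥ_ = ≡-dec _≟_

-- the entry at a step that places the (m+1)-st element, t steps before spanning
stepEntry : ℕ → ℕ → ℕ → ℕ
stepEntry r m zero    = 1
stepEntry r m (suc t) = 𝟙 (suc m <? r)

-- the rank sequence of length k after m placed elements, spanning after t more steps
pavingSeq : ℕ → ℕ → ℕ → (k : ℕ) → Vec ℕ k
pavingSeq r m t       zero    = []
pavingSeq r m zero    (suc k) = 0 ∷ pavingSeq r (suc m) zero k
pavingSeq r m (suc t) (suc k) = stepEntry r m t ∷ pavingSeq r (suc m) t k

module SpanningTime {n : ℕ} (M : Matroid n) where

  open RankFacts M
  open Arrangements n

  spanTime : ∀ {k} → Subset n → Vec (Fin n) k → ℕ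
  spanTime U []      = 0
  spanTime U (x ∷ v) with spanning? U
  ... | yes _ = 0
  ... | no _  = suc (spanTime (U ∪ ⁅ x ⁆) v)

  spanTime≤ : ∀ {k} U (v : Vec (Fin n) k) → spanTime U v ≤ k
  spanTime≤ U []      = z≤n
  spanTime≤ U (x ∷ v) with spanning? U
  ... | yes _ = z≤n
  ... | no _  = s≤s (spanTime≤ (U ∪ ⁅ x ⁆) v)

  spanTime-spanning : ∀ {k} U (v : Vec (Fin n) k) → Spanning U → spanTime U v ≡ 0
  spanTime-spanning U []      spU = refl
  spanTime-spanning U (x ∷ v) spU with spanning? U
  ... | yes _  = refl
  ... | no ¬sp = ⊥-elim (¬sp spU)

  completes-[]-spanning : ∀ {U} → Completes U [] → Spanning U
  completes-[]-spanning c = spanning-⊆ {⊤} refl (completes-[] c)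

  spanTime-nonspanning : ∀ {k} U (v : Vec (Fin n) k) → Completes U v → ¬ Spanning U → ∃ λ t → spanTime U v ≡ suc t
  spanTime-nonspanning U []      c ¬spU = ⊥-elim (¬spU (completes-[]-spanning c))
  spanTime-nonspanning U (x ∷ v) c ¬spU with spanning? U
  ... | yes spU = ⊥-elim (¬spU spU)
  ... | no _    = spanTime (U ∪ ⁅ x ⁆) v , refl

  spanTime>⇔prefix-nonspanning : ∀ {k} j U (v : Vec (Fin n) k) → Completes U v →
    𝟙 (j <? spanTime U v) ≡ 𝟙 (¬? (spanning? (U ∪ prefix j v)))
  spanTime>⇔prefix-nonspanning j U [] c =
    sym (𝟙-no (λ ¬sp → ¬sp (spanning-⊆ (completes-[]-spanning c) (p⊆p∪q (prefix j []))))
              (¬? (spanning? (U ∪ prefix j []))))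
  spanTime>⇔prefix-nonspanning j U (x ∷ v) c with spanning? U
  ... | yes spU =
    sym (𝟙-no (λ ¬sp → ¬sp (spanning-⊆ spU (p⊆p∪q (prefix j (x ∷ v))))) (¬? (spanning? (U ∪ prefix j (x ∷ v)))))
  spanTime>⇔prefix-nonspanning zero    U (x ∷ v) c | no ¬spU =
    sym (𝟙-yes (λ sp → ¬spU (trans (cong ρ (sym (∪-identityʳ U))) sp)) (¬? (spanning? (U ∪ ⊥))))
  spanTime>⇔prefix-nonspanning (suc j) U (x ∷ v) c | no ¬spU = begin
    𝟙 (suc j <? suc (spanTime (U ∪ ⁅ x ⁆) v))
      ≡⟨ 𝟙-⇔ (suc j <? suc (spanTime (U ∪ ⁅ x ⁆) v)) (j <? spanTime (U ∪ ⁅ x ⁆) v) ≤-pred s≤s ⟩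
    𝟙 (j <? spanTime (U ∪ ⁅ x ⁆) v)
      ≡⟨ spanTime>⇔prefix-nonspanning j (U ∪ ⁅ x ⁆) v (completes-tail c) ⟩
    𝟙 (¬? (spanning? ((U ∪ ⁅ x ⁆) ∪ prefix j v)))
      ≡⟨ cong (λ T → 𝟙 (¬? (spanning? T))) (∪-assoc U ⁅ x ⁆ (prefix j v)) ⟩
    𝟙 (¬? (spanning? (U ∪ (⁅ x ⁆ ∪ prefix j v)))) ∎
    where open ≡-Reasoning

  -- the first j entries of a completion are distinct and outside U
  prefix-size : ∀ {k} j U (v : Vec (Fin n) k) → ∣ U ∣ + k ≡ n → Completes U v → j ≤ k →
                ∣ U ∪ prefix j v ∣ ≡ ∣ U ∣ + j
  prefix-size zero    U v       tight c j≤k = trans (cong ∣_∣ (∪-identityʳ U)) (sym (+-identityʳ _))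
  prefix-size {suc k} (suc j) U (x ∷ v) tight c (s≤s j≤k) = begin
    ∣ U ∪ (⁅ x ⁆ ∪ prefix j v) ∣ ≡⟨ cong ∣_∣ (sym (∪-assoc U ⁅ x ⁆ (prefix j v))) ⟩
    ∣ (U ∪ ⁅ x ⁆) ∪ prefix j v ∣ ≡⟨ prefix-size j (U ∪ ⁅ x ⁆) v (tight-step U x x∉U tight) (completes-tail c) j≤k ⟩
    ∣ U ∪ ⁅ x ⁆ ∣ + j           ≡⟨ cong (_+ j) (∣∪⁅⁆∣ x U x∉U) ⟩
    suc ∣ U ∣ + j               ≡⟨ sym (+-suc ∣ U ∣ j) ⟩
    ∣ U ∣ + suc j               ∎
    where
    open ≡-Reasoning
    x∉U : x ∉ U
    x∉U = completes-head tight c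

  module _ (paving : Paving M) where

    open PavingFacts M paving

    firstEntry : ∀ {k} U x (v : Vec (Fin n) k) → x ∉ U → Completes (U ∪ ⁅ x ⁆) v → ¬ Spanning U →
                 ρ (U ∪ ⁅ x ⁆) ∸ ρ U ≡ stepEntry r ∣ U ∣ (spanTime (U ∪ ⁅ x ⁆) v)
    firstEntry U x v x∉U c ¬spU with spanning? (U ∪ ⁅ x ⁆)
    ... | yes spU+x rewrite spanTime-spanning (U ∪ ⁅ x ⁆) v spU+x = increment-spanning U x ¬spU spU+x
    ... | no ¬spU+x with spanTime-nonspanning (U ∪ ⁅ x ⁆) v c ¬spU+x
    ...   | t , spanTime≡ rewrite spanTime≡ = increment-nonspanning U x x∉U ¬spU+x

    step-shape : ∀ {k} U x (v : Vec (Fin n) k) → x ∉ U → Completes (U ∪ ⁅ x ⁆) v →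
      (ρ (U ∪ ⁅ x ⁆) ∸ ρ U) ∷ pavingSeq r (suc ∣ U ∣) (spanTime (U ∪ ⁅ x ⁆) v) k
        ≡ pavingSeq r ∣ U ∣ (spanTime U (x ∷ v)) (suc k)
    step-shape {k} U x v x∉U c with spanning? U
    ... | yes spU = cong₂ _∷_ (trans (cong₂ _∸_ spU+x spU) (n∸n≡0 r))
                              (cong (λ t → pavingSeq r (suc ∣ U ∣) t k) (spanTime-spanning (U ∪ ⁅ x ⁆) v spU+x))
      where
      spU+x : Spanning (U ∪ ⁅ x ⁆)
      spU+x = spanning-⊆ spU (p⊆p∪q ⁅ x ⁆)
    ... | no ¬spU = cong (_∷ pavingSeq r (suc ∣ U ∣) (spanTime (U ∪ ⁅ x ⁆) v) k) (firstEntry U x v x∉U c ¬spU)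

    rankSeq-shape : ∀ {k} U (v : Vec (Fin n) k) → ∣ U ∣ + k ≡ n → Completes U v →
                    rankSeqFrom M U v ≡ pavingSeq r ∣ U ∣ (spanTime U v) k
    rankSeq-shape U [] tight c = refl
    rankSeq-shape {suc k} U (x ∷ v) tight c = begin
      (ρ (U ∪ ⁅ x ⁆) ∸ ρ U) ∷ rankSeqFrom M (U ∪ ⁅ x ⁆) v
        ≡⟨ cong ((ρ (U ∪ ⁅ x ⁆) ∸ ρ U) ∷_) (rankSeq-shape (U ∪ ⁅ x ⁆) v (tight-step U x x∉U tight) (completes-tail c)) ⟩
      (ρ (U ∪ ⁅ x ⁆) ∸ ρ U) ∷ pavingSeq r (∣ U ∪ ⁅ x ⁆ ∣) (spanTime (U ∪ ⁅ x ⁆) v) k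
        ≡⟨ cong (λ m → (ρ (U ∪ ⁅ x ⁆) ∸ ρ U) ∷ pavingSeq r m (spanTime (U ∪ ⁅ x ⁆) v) k) (∣∪⁅⁆∣ x U x∉U) ⟩
      (ρ (U ∪ ⁅ x ⁆) ∸ ρ U) ∷ pavingSeq r (suc ∣ U ∣) (spanTime (U ∪ ⁅ x ⁆) v) k
        ≡⟨ step-shape U x v x∉U (completes-tail c) ⟩
      pavingSeq r (∣ U ∣) (spanTime U (x ∷ v)) (suc k) ∎
      where
      open ≡-Reasoning
      x∉U : x ∉ U
      x∉U = completes-head tight c

-- Counting copoints.  In a paving matroid of rank r and for j ≥ r, the j-sets
-- of rank r - 1 are exactly the j-subsets of the non-trivial copoints, each
-- lying in a unique one; hence their number is ∑_k (k C j) · #{non-trivial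
-- copoints with k elements}.

module CopointCounts {n : ℕ} (M : Matroid n) where

  open RankFacts M

  ∑-nontrivial-by-size : ∀ j →
    ∑ (allSubsets n) (λ H → 𝟙 (nontrivialCopoint? M H) * (∣ H ∣ C j)) ≡
    ∑ (below (suc n)) (λ k → (k C j) * numNontrivialCopoints M k)
  ∑-nontrivial-by-size j =
    trans (∑-fibres (allSubsets n) ∣_∣ (suc n) (λ H → s≤s (∣p∣≤n H)) _)
          (∑-cong (below (suc n)) (λ k → begin
      ∑ (allSubsets n) (λ H → 𝟙 (∣ H ∣ ≟ k) * (𝟙 (nontrivialCopoint? M H) * (∣ H ∣ C j)))
        ≡⟨ ∑-cong (allSubsets n) (λ H → sizeK H k) ⟩
      ∑ (allSubsets n) (λ H → (k C j) * 𝟙 (nontrivialCopoint? M H ×-dec (∣ H ∣ ≟ k)))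
        ≡⟨ ∑-*ˡ (allSubsets n) ((k C j)) _ ⟩
      (k C j) * ∑ (allSubsets n) (λ H → 𝟙 (nontrivialCopoint? M H ×-dec (∣ H ∣ ≟ k)))
        ≡⟨ cong ((k C j) *_) (sym (count≡∑ _ (allSubsets n))) ⟩
      (k C j) * numNontrivialCopoints M k ∎))
    where
    open ≡-Reasoning
    sizeK : ∀ H k → 𝟙 (∣ H ∣ ≟ k) * (𝟙 (nontrivialCopoint? M H) * (∣ H ∣ C j)) ≡
                    (k C j) * 𝟙 (nontrivialCopoint? M H ×-dec (∣ H ∣ ≟ k))
    sizeK H k = begin
      𝟙 (∣ H ∣ ≟ k) * (𝟙 (nontrivialCopoint? M H) * (∣ H ∣ C j))
        ≡⟨ 𝟙-transport _≟_ ∣ H ∣ k (λ m → 𝟙 (nontrivialCopoint? M H) * (m C j)) ⟩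
      𝟙 (∣ H ∣ ≟ k) * (𝟙 (nontrivialCopoint? M H) * (k C j))
        ≡⟨ solve 3 (λ a b c → a :* (b :* c) := c :* (b :* a)) refl (𝟙 (∣ H ∣ ≟ k)) (𝟙 (nontrivialCopoint? M H)) ((k C j)) ⟩
      (k C j) * (𝟙 (nontrivialCopoint? M H) * 𝟙 (∣ H ∣ ≟ k))
        ≡⟨ cong ((k C j) *_) (sym (𝟙-× (nontrivialCopoint? M H) (∣ H ∣ ≟ k))) ⟩
      (k C j) * 𝟙 (nontrivialCopoint? M H ×-dec (∣ H ∣ ≟ k)) ∎

  module _ (paving : Paving M) where

    open PavingFacts M paving

    #copoints-above : ∀ S → r ≤ ∣ S ∣ →
      ∑ (allSubsets n) (λ H → 𝟙 (nontrivialCopoint? M H) * 𝟙 (S ⊆? H)) ≡ 𝟙 (suc (ρ S) ≟ r)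
    #copoints-above S r≤∣S∣ with suc (ρ S) ≟ r
    ... | yes ρS+1≡r = trans (∑-cong (allSubsets n) onlyClosure) (∑-point n (cl S) (λ _ → 1))
      where
      onlyClosure : ∀ H → 𝟙 (nontrivialCopoint? M H) * 𝟙 (S ⊆? H) ≡ 𝟙 (cl S ≟S H) * 1
      onlyClosure H = trans (sym (𝟙-× (nontrivialCopoint? M H) (S ⊆? H)))
        (trans (𝟙-⇔ (nontrivialCopoint? M H ×-dec S ⊆? H) (cl S ≟S H)
                  (λ (ntH , S⊆H) → sym (copoint-unique S H ρS+1≡r (proj₁ ntH) S⊆H))
                  (λ { refl → cl-nontrivial S ρS+1≡r r≤∣S∣ , ⊆cl S }))
               (sym (*-identityʳ _)))
    ... | no ρS+1≢r = ∑-zero (allSubsets n) (λ H → trans (sym (𝟙-× (nontrivialCopoint? M H) (S ⊆? H)))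
                                                          (𝟙-no notInCopoint (nontrivialCopoint? M H ×-dec S ⊆? H)))
      where
      notInCopoint : ∀ {H} → ¬ (NontrivialCopoint M H × S ⊆ H)
      notInCopoint {H} (((_ , ρH+1≡r) , _) , S⊆H) with profile S
      ... | spanning spS = <-irrefl refl (<-≤-trans (subst (ρ H <_) ρH+1≡r (n<1+n (ρ H)))
                                                    (≤-trans (≤-reflexive (sym spS)) (ρ-mono S⊆H)))
      ... | free _ ∣S∣+1<r = <-irrefl refl (<-≤-trans ∣S∣+1<r (≤-trans r≤∣S∣ (n≤1+n _)))
      ... | nonspanning ρS+1≡r _ = ρS+1≢r ρS+1≡r

    #rank-r-1-sets : ∀ j → r ≤ j →
      ∑ (allSubsets n) (λ S → 𝟙 (∣ S ∣ ≟ j) * 𝟙 (suc (ρ S) ≟ r)) ≡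
      ∑ (below (suc n)) (λ k → (k C j) * numNontrivialCopoints M k)
    #rank-r-1-sets j r≤j = begin
      ∑ (allSubsets n) (λ S → 𝟙 (∣ S ∣ ≟ j) * 𝟙 (suc (ρ S) ≟ r))
        ≡⟨ ∑-cong (allSubsets n) (λ S → 𝟙-guard (∣ S ∣ ≟ j) (λ ∣S∣≡j →
             sym (#copoints-above S (subst (r ≤_) (sym ∣S∣≡j) r≤j)))) ⟩
      ∑ (allSubsets n) (λ S → 𝟙 (∣ S ∣ ≟ j) * ∑ (allSubsets n) (λ H → 𝟙 (nontrivialCopoint? M H) * 𝟙 (S ⊆? H)))
        ≡⟨ ∑-cong (allSubsets n) (λ S → trans (sym (∑-*ˡ (allSubsets n) (𝟙 (∣ S ∣ ≟ j)) _))
             (∑-cong (allSubsets n) (λ H → solve 3 (λ a b c → a :* (b :* c) := b :* (a :* c)) refl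
               (𝟙 (∣ S ∣ ≟ j)) (𝟙 (nontrivialCopoint? M H)) (𝟙 (S ⊆? H))))) ⟩
      ∑ (allSubsets n) (λ S → ∑ (allSubsets n) (λ H → 𝟙 (nontrivialCopoint? M H) * (𝟙 (∣ S ∣ ≟ j) * 𝟙 (S ⊆? H))))
        ≡⟨ ∑-swap (allSubsets n) (allSubsets n) _ ⟩
      ∑ (allSubsets n) (λ H → ∑ (allSubsets n) (λ S → 𝟙 (nontrivialCopoint? M H) * (𝟙 (∣ S ∣ ≟ j) * 𝟙 (S ⊆? H))))
        ≡⟨ ∑-cong (allSubsets n) (λ H → trans (∑-*ˡ (allSubsets n) (𝟙 (nontrivialCopoint? M H)) _)
             (cong (𝟙 (nontrivialCopoint? M H) *_) (#subsets n H j))) ⟩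
      ∑ (allSubsets n) (λ H → 𝟙 (nontrivialCopoint? M H) * (∣ H ∣ C j))
        ≡⟨ ∑-nontrivial-by-size j ⟩
      ∑ (below (suc n)) (λ k → (k C j) * numNontrivialCopoints M k) ∎
      where open ≡-Reasoning

-- Sparse paving matroids.  Here every r-set is either a basis or a non-trivial
-- copoint (and not both), and there are no other non-trivial copoints; so the
-- number of bases determines all the numbers of non-trivial copoints.

module SparsePavingFacts {n : ℕ} (M : Matroid n) (sparse : SparsePaving M) where

  open RankFacts M
  open PavingFacts M (proj₁ sparse)

  basis-or-copoint : ∀ X → 𝟙 (nontrivialCopoint? M X ×-dec (∣ X ∣ ≟ r)) + 𝟙 (basis? M X) ≡ 𝟙 (∣ X ∣ ≟ r)
  basis-or-copoint X with ∣ X ∣ ≟ r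
  ... | no ∣X∣≢r = cong₂ _+_ (trans (𝟙-× (nontrivialCopoint? M X) (no ∣X∣≢r)) (*-zeroʳ (𝟙 (nontrivialCopoint? M X))))
                             (𝟙-no (λ B → ∣X∣≢r (trans (sym (proj₁ B)) (basis-spanning X B))) (basis? M X))
  ... | yes ∣X∣≡r with nontrivialCopoint? M X
  ...   | yes ntX = cong (1 +_) (𝟙-no (λ B → 1+n≢n (trans (proj₂ (proj₁ ntX)) (sym (basis-spanning X B)))) (basis? M X))
  ...   | no ¬ntX = 𝟙-yes isBasis (basis? M X)
    where
    isBasis : Basis M X
    isBasis with profile X
    ... | spanning spX = trans spX (sym ∣X∣≡r) ,
                         λ e e∉X indep → 1+n≰n (subst (_≤ r) (trans indep (trans (∣∪⁅⁆∣ e X e∉X) (cong suc ∣X∣≡r))) (ρ≤r _))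
    ... | free _ ∣X∣+1<r = ⊥-elim (<-irrefl ∣X∣≡r (<-trans (n<1+n _) ∣X∣+1<r))
    ... | nonspanning ρX+1≡r _ = ⊥-elim (¬ntX (subst (NontrivialCopoint M) (sym X≡cl) ntcl))
      where
      -- X would be a non-trivial copoint: its closure is one, and has only r = ∣ X ∣ elements
      ntcl : NontrivialCopoint M (cl X)
      ntcl = cl-nontrivial X ρX+1≡r (≤-reflexive (sym ∣X∣≡r))
      X≡cl : X ≡ cl X
      X≡cl = ⊆-card-eq X (cl X) (⊆cl X) (trans ∣X∣≡r (sym (proj₂ sparse (cl X) ntcl)))

  copoints+bases : numNontrivialCopoints M r + numBases M ≡ ∑ (allSubsets n) (λ X → 𝟙 (∣ X ∣ ≟ r))
  copoints+bases = trans (cong₂ _+_ (count≡∑ _ (allSubsets n)) (count≡∑ _ (allSubsets n)))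
                         (trans (sym (∑-+ (allSubsets n) _ _)) (∑-cong (allSubsets n) basis-or-copoint))

  no-other-copoints : ∀ k → ¬ k ≡ r → numNontrivialCopoints M k ≡ 0
  no-other-copoints k k≢r = trans (count≡∑ _ (allSubsets n)) (∑-zero (allSubsets n) (λ X →
    𝟙-no (λ (ntX , ∣X∣≡k) → k≢r (trans (sym ∣X∣≡k) (proj₂ sparse X ntX)))
         (nontrivialCopoint? M X ×-dec (∣ X ∣ ≟ k))))

sparse-copoint-counts : ∀ {n} (P P′ : Matroid n) → SparsePaving P → SparsePaving P′ →
  rank P ≡ rank P′ → numBases P ≡ numBases P′ → ∀ k → numNontrivialCopoints P k ≡ numNontrivialCopoints P′ k
sparse-copoint-counts {n} P P′ sparse sparse′ rank≡ bases≡ k with k ≟ rank P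
... | yes refl = +-cancelʳ-≡ (numBases P) _ _ (begin
  numNontrivialCopoints P (rank P) + numBases P    ≡⟨ S.copoints+bases ⟩
  ∑ (allSubsets n) (λ X → 𝟙 (∣ X ∣ ≟ rank P))      ≡⟨ cong (λ m → ∑ (allSubsets n) (λ X → 𝟙 (∣ X ∣ ≟ m))) rank≡ ⟩
  ∑ (allSubsets n) (λ X → 𝟙 (∣ X ∣ ≟ rank P′))     ≡⟨ sym S′.copoints+bases ⟩
  numNontrivialCopoints P′ (rank P′) + numBases P′ ≡⟨ cong₂ _+_ (cong (numNontrivialCopoints P′) (sym rank≡)) (sym bases≡) ⟩
  numNontrivialCopoints P′ (rank P) + numBases P   ∎)
  where
  open ≡-Reasoning
  module S  = SparsePavingFacts P sparse
  module S′ = SparsePavingFacts P′ sparse′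
... | no k≢r = trans (SparsePavingFacts.no-other-copoints P sparse k k≢r)
                     (sym (SparsePavingFacts.no-other-copoints P′ sparse′ k (λ e → k≢r (trans e (sym rank≡)))))

-- The G-invariant of a paving matroid.  By rankSeq-shape, the coefficient of
-- [s] in G(M) is ∑_t [pavingSeq r 0 t n = s] · #{π : spanTime π = t}.  The
-- spanning-time counts telescope against late j = #{π : spanTime π > j}, the
-- number of permutations whose first j elements do not span, and late j is
-- #permutations for j < r, 0 for j ≥ n, and otherwise
-- j! (n ∸ j)! · #{j-sets of rank r - 1}, which only depends on the numbers of
-- non-trivial copoints of each size.

module GInvariantOfPaving {n : ℕ} (M : Matroid n) (paving : Paving M) where

  open RankFacts M
  open PavingFacts M paving
  open Arrangements n
  open SpanningTime M
  open CopointCounts M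

  -- the number of all permutations (independent of M)
  #permutations : ℕ
  #permutations = ∑ (vectors n) (λ π → 𝟙 (completes? ⊥ π))

  spanCount : ℕ → ℕ
  spanCount t = ∑ (vectors n) (λ π → 𝟙 (spanTime ⊥ π ≟ t) * 𝟙 (completes? ⊥ π))

  late : ℕ → ℕ
  late j = ∑ (vectors n) (λ π → 𝟙 (j <? spanTime ⊥ π) * 𝟙 (completes? ⊥ π))

  ⊥-tight : ∣ ⊥ {n} ∣ + n ≡ n
  ⊥-tight = cong (_+ n) (∣⊥∣≡0 n)

  G-by-spanTime : ∀ s → Gcoeff M s ≡ ∑ (below (suc n)) (λ t → 𝟙 (pavingSeq r 0 t n ≟ᵥ s) * spanCount t)
  G-by-spanTime s = begin
    Gcoeff M s
      ≡⟨ count≡∑ _ (allPerms n) ⟩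
    ∑ (allPerms n) (λ π → 𝟙 (rankSeq M π ≟ᵥ s))
      ≡⟨ ∑-filter isPerm? (vectors n) _ ⟩
    ∑ (vectors n) (λ π → 𝟙 (isPerm? π) * 𝟙 (rankSeq M π ≟ᵥ s))
      ≡⟨ ∑-cong (vectors n) byShape ⟩
    ∑ (vectors n) (λ π → 𝟙 (completes? ⊥ π) * 𝟙 (pavingSeq r 0 (spanTime ⊥ π) n ≟ᵥ s))
      ≡⟨ ∑-fibres (vectors n) (spanTime ⊥) (suc n) (λ π → s≤s (spanTime≤ ⊥ π)) _ ⟩
    ∑ (below (suc n)) (λ t → ∑ (vectors n) (λ π → 𝟙 (spanTime ⊥ π ≟ t) * (𝟙 (completes? ⊥ π) * 𝟙 (pavingSeq r 0 (spanTime ⊥ π) n ≟ᵥ s))))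
      ≡⟨ ∑-cong (below (suc n)) (λ t → trans (∑-cong (vectors n) (atTime t)) (∑-*ˡ (vectors n) (𝟙 (pavingSeq r 0 t n ≟ᵥ s)) _)) ⟩
    ∑ (below (suc n)) (λ t → 𝟙 (pavingSeq r 0 t n ≟ᵥ s) * spanCount t) ∎
    where
    open ≡-Reasoning
    byShape : ∀ π → 𝟙 (isPerm? π) * 𝟙 (rankSeq M π ≟ᵥ s) ≡ 𝟙 (completes? ⊥ π) * 𝟙 (pavingSeq r 0 (spanTime ⊥ π) n ≟ᵥ s)
    byShape π = trans (cong (_* 𝟙 (rankSeq M π ≟ᵥ s)) (permutation⇔completes⊥ π))
      (𝟙-guard (completes? ⊥ π) (λ c → cong (λ w → 𝟙 (w ≟ᵥ s))
        (trans (rankSeq-shape paving ⊥ π ⊥-tight c) (cong (λ m → pavingSeq r m (spanTime ⊥ π) n) (∣⊥∣≡0 n)))))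
    atTime : ∀ t π → 𝟙 (spanTime ⊥ π ≟ t) * (𝟙 (completes? ⊥ π) * 𝟙 (pavingSeq r 0 (spanTime ⊥ π) n ≟ᵥ s)) ≡
                     𝟙 (pavingSeq r 0 t n ≟ᵥ s) * (𝟙 (spanTime ⊥ π ≟ t) * 𝟙 (completes? ⊥ π))
    atTime t π = trans (𝟙-transport _≟_ (spanTime ⊥ π) t (λ u → 𝟙 (completes? ⊥ π) * 𝟙 (pavingSeq r 0 u n ≟ᵥ s)))
      (solve 3 (λ a b c → a :* (b :* c) := c :* (a :* b)) refl
        (𝟙 (spanTime ⊥ π ≟ t)) (𝟙 (completes? ⊥ π)) (𝟙 (pavingSeq r 0 t n ≟ᵥ s)))

  spanCount-zero : spanCount 0 + late 0 ≡ #permutations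
  spanCount-zero = trans (sym (∑-+ (vectors n) _ _)) (∑-cong (vectors n) (λ π →
    trans (sym (*-distribʳ-+ (𝟙 (completes? ⊥ π)) (𝟙 (spanTime ⊥ π ≟ 0)) (𝟙 (0 <? spanTime ⊥ π))))
          (trans (cong (_* 𝟙 (completes? ⊥ π)) (𝟙-split-zero (spanTime ⊥ π))) (*-identityˡ _))))

  spanCount-suc : ∀ t → spanCount (suc t) + late (suc t) ≡ late t
  spanCount-suc t = trans (sym (∑-+ (vectors n) _ _)) (∑-cong (vectors n) (λ π →
    trans (sym (*-distribʳ-+ (𝟙 (completes? ⊥ π)) (𝟙 (spanTime ⊥ π ≟ suc t)) (𝟙 (suc t <? spanTime ⊥ π))))
          (cong (_* 𝟙 (completes? ⊥ π)) (𝟙-split-suc (spanTime ⊥ π) t))))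

  late-by-prefix : ∀ j → late j ≡ ∑ (vectors n) (λ π → 𝟙 (completes? ⊥ π) * 𝟙 (¬? (spanning? (⊥ ∪ prefix j π))))
  late-by-prefix j = ∑-cong (vectors n) (λ π → trans (*-comm (𝟙 (j <? spanTime ⊥ π)) (𝟙 (completes? ⊥ π)))
    (𝟙-guard (completes? ⊥ π) (λ c → spanTime>⇔prefix-nonspanning j ⊥ π c)))

  prefix-size-⊥ : ∀ j (π : Vec (Fin n) n) → Completes ⊥ π → j ≤ n → ∣ ⊥ ∪ prefix j π ∣ ≡ j
  prefix-size-⊥ j π c j≤n = trans (prefix-size j ⊥ π ⊥-tight c j≤n) (cong (_+ j) (∣⊥∣≡0 n))

  late-small : ∀ j → j < r → late j ≡ #permutations
  late-small j j<r = trans (late-by-prefix j) (∑-cong (vectors n) (λ π →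
    trans (𝟙-guard (completes? ⊥ π) (λ c → 𝟙-yes (tooSmall π c) (¬? (spanning? (⊥ ∪ prefix j π))))) (*-identityʳ _)))
    where
    r≤n : r ≤ n
    r≤n = ≤-trans (rk-card M ⊤) (≤-reflexive (∣⊤∣≡n n))
    tooSmall : ∀ π → Completes ⊥ π → ¬ Spanning (⊥ ∪ prefix j π)
    tooSmall π c sp = <-irrefl sp (≤-<-trans (≤-trans (rk-card M _) (≤-reflexive (prefix-size-⊥ j π c (≤-trans (<⇒≤ j<r) r≤n)))) j<r)

  late-large : ∀ j → n ≤ j → late j ≡ 0
  late-large j n≤j = ∑-zero (vectors n) (λ π → cong (_* 𝟙 (completes? ⊥ π))
    (𝟙-no (λ j<τ → <-irrefl refl (<-≤-trans j<τ (≤-trans (spanTime≤ ⊥ π) n≤j))) (j <? spanTime ⊥ π)))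

  late-middle : ∀ j → r ≤ j → j ≤ n →
    late j ≡ j ! * (n ∸ j) ! * ∑ (below (suc n)) (λ k → (k C j) * numNontrivialCopoints M k)
  late-middle j r≤j j≤n = begin
    late j
      ≡⟨ late-by-prefix j ⟩
    ∑ (vectors n) (λ π → 𝟙 (completes? ⊥ π) * 𝟙 (¬? (spanning? (⊥ ∪ prefix j π))))
      ≡⟨ ∑-cong (vectors n) (λ π → 𝟙-guard (completes? ⊥ π) (λ c →
           nonspanning⇔corank1 (⊥ ∪ prefix j π) (subst (r ≤_) (sym (prefix-size-⊥ j π c j≤n)) r≤j))) ⟩
    ∑ (vectors n) (λ π → 𝟙 (completes? ⊥ π) * 𝟙 (suc (ρ (⊥ ∪ prefix j π)) ≟ r))
      ≡⟨ ∑-prefixes j n ⊥ ⊥-tight j≤n (λ S → 𝟙 (suc (ρ S) ≟ r)) ⟩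
    j ! * (n ∸ j) ! * ∑⊇ ⊥ (∣ ⊥ {n} ∣ + j) (λ S → 𝟙 (suc (ρ S) ≟ r))
      ≡⟨ cong (λ m → j ! * (n ∸ j) ! * ∑⊇ ⊥ (m + j) (λ S → 𝟙 (suc (ρ S) ≟ r))) (∣⊥∣≡0 n) ⟩
    j ! * (n ∸ j) ! * ∑⊇ ⊥ j (λ S → 𝟙 (suc (ρ S) ≟ r))
      ≡⟨ cong (j ! * (n ∸ j) ! *_) (trans (∑⊇-⊥ j _) (#rank-r-1-sets paving j r≤j)) ⟩
    j ! * (n ∸ j) ! * ∑ (below (suc n)) (λ k → (k C j) * numNontrivialCopoints M k) ∎
    where open ≡-Reasoning

-- Paving matroids of equal rank with the same numbers of non-trivial copoints
-- of each size have the same late counts, hence (telescoping) the same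
-- spanning-time counts, hence the same G-invariant.
paving-G-determined : ∀ {n} (P P′ : Matroid n) → Paving P → Paving P′ → rank P ≡ rank P′ →
  (∀ k → numNontrivialCopoints P k ≡ numNontrivialCopoints P′ k) → P ≡G P′
paving-G-determined {n} P P′ paving paving′ rank≡ copoints≡ s = begin
  Gcoeff P s
    ≡⟨ G.G-by-spanTime s ⟩
  ∑ (below (suc n)) (λ t → 𝟙 (pavingSeq (rank P) 0 t n ≟ᵥ s) * G.spanCount t)
    ≡⟨ ∑-cong (below (suc n)) (λ t → cong₂ _*_ (cong (λ m → 𝟙 (pavingSeq m 0 t n ≟ᵥ s)) rank≡) (spanCount-agree t)) ⟩
  ∑ (below (suc n)) (λ t → 𝟙 (pavingSeq (rank P′) 0 t n ≟ᵥ s) * G′.spanCount t)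
    ≡⟨ sym (G′.G-by-spanTime s) ⟩
  Gcoeff P′ s ∎
  where
  open ≡-Reasoning
  module G  = GInvariantOfPaving P paving
  module G′ = GInvariantOfPaving P′ paving′

  late-agree : ∀ j → G.late j ≡ G′.late j
  late-agree j with n ≤? j | j <? rank P
  ... | yes n≤j | _       = trans (G.late-large j n≤j) (sym (G′.late-large j n≤j))
  ... | no _    | yes j<r = trans (G.late-small j j<r) (sym (G′.late-small j (subst (j <_) rank≡ j<r)))
  ... | no n≰j  | no j≮r  = begin
    G.late j
      ≡⟨ G.late-middle j (≮⇒≥ j≮r) (<⇒≤ (≰⇒> n≰j)) ⟩
    j ! * (n ∸ j) ! * ∑ (below (suc n)) (λ k → (k C j) * numNontrivialCopoints P k)
      ≡⟨ cong (j ! * (n ∸ j) ! *_) (∑-cong (below (suc n)) (λ k → cong ((k C j) *_) (copoints≡ k))) ⟩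
    j ! * (n ∸ j) ! * ∑ (below (suc n)) (λ k → (k C j) * numNontrivialCopoints P′ k)
      ≡⟨ sym (G′.late-middle j (subst (_≤ j) rank≡ (≮⇒≥ j≮r)) (<⇒≤ (≰⇒> n≰j))) ⟩
    G′.late j ∎

  -- telescoping: spanCount t + late t = late (t - 1), with late (-1) = #permutations
  spanCount-agree : ∀ t → G.spanCount t ≡ G′.spanCount t
  spanCount-agree zero    = +-cancelʳ-≡ (G.late 0) _ _
    (trans G.spanCount-zero (trans (sym G′.spanCount-zero) (cong (G′.spanCount 0 +_) (sym (late-agree 0)))))
  spanCount-agree (suc t) = +-cancelʳ-≡ (G.late (suc t)) _ _
    (trans (G.spanCount-suc t) (trans (late-agree t)
      (trans (sym (G′.spanCount-suc t)) (cong (G′.spanCount (suc t) +_) (sym (late-agree (suc t)))))))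

mainTheorem8 : (∀ (n r : ℕ) (P P′ : Matroid n) → rank P ≡ r → rank P′ ≡ r →
    Paving P → Paving P′ →
    (∀ (k : ℕ) → numNontrivialCopoints P k ≡ numNontrivialCopoints P′ k) →
    P ≡G P′)
    ×
    (∀ (n : ℕ) (P P′ : Matroid n) → SparsePaving P → SparsePaving P′ →
    rank P ≡ rank P′ → numBases P ≡ numBases P′ →
    P ≡G P′)
mainTheorem8 = pavingCase , sparseCase
  where
  pavingCase : ∀ (n r : ℕ) (P P′ : Matroid n) → rank P ≡ r → rank P′ ≡ r → Paving P → Paving P′ →
    (∀ (k : ℕ) → numNontrivialCopoints P k ≡ numNontrivialCopoints P′ k) → P ≡G P′
  pavingCase n r P P′ rankP rankP′ paving paving′ =
    paving-G-determined P P′ paving paving′ (trans rankP (sym rankP′))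
  sparseCase : ∀ (n : ℕ) (P P′ : Matroid n) → SparsePaving P → SparsePaving P′ →
    rank P ≡ rank P′ → numBases P ≡ numBases P′ → P ≡G P′
  sparseCase n P P′ sparse sparse′ rank≡ bases≡ =
    paving-G-determined P P′ (proj₁ sparse) (proj₁ sparse′) rank≡
      (sparse-copoint-counts P P′ sparse sparse′ rank≡ bases≡)
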